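{- Let $\lambda,\mu,n$ be natural numbers with $\lambda\ge1$ and $\lambda+(\lambda-\mu)n>1$. Then \[ \sum_{k=0}^{n}(-1)^{k\lambda}\binom{n}{k}^{\lambda}\binom{n+k}{k}^{\mu}\,\Omega_{\lambda-1}(\lambda,\mu,-k)=0, \] where for $0\le k\le n$ and $\ell\ge 0$, \[ \Omega_\ell(\lambda,\mu,-k)=\ell!\sum_{\substack{(m_1,\dots,m_\ell)\in\mathbb{Z}_{\ge0}^\ell\\ \sum_{i=1}^\ell i m_i=\ell}}\ \prod_{i=1}^{\ell}\frac{\Big\{\lambda\big[H_k^{\langle i\rangle}+(-1)^iH_{n-k}^{\langle i\rangle}\big]+\mu\big[H_k^{\langle i\rangle}-H_{n+k}^{\langle i\rangle}\big]\Big\}^{m_i}}{m_i!\,i^{m_i}} \] (so $\Omega_0(\lambda,\mu,-k)=1$).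
   Context: For $m\ge1$, the generalized harmonic numbers are $H_0^{\langle m\rangle}=0$ and $H_n^{\langle m\rangle}=\sum_{j=1}^n j^{ -m}$ for $n\ge1$. The inner sum in the definition of $\Omega_\ell$ runs over all partitions of $\ell$, encoded as $\ell$-tuples of nonnegative integers $(m_1,\dots,m_\ell)$ with $\sum_i i m_i=\ell$ (for $\ell=0$ the sum has the single empty term, equal to $1$). -}

module Defs where

open import Data.Nat as ℕ using (ℕ; zero; suc; _∸_; _!)
open import Data.Nat.Combinatorics using (_C_)
open import Data.Integer as ℤ using (ℤ; +_)
open import Data.Rational as ℚ using (ℚ; 0ℚ; 1ℚ; _/_)
open import Data.List using (List; []; _∷_; map; foldr; concatMap; filterᵇ; upTo)

sumℚ : List ℚ → ℚ
sumℚ = foldr ℚ._+_ 0ℚ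

_^ℚ_ : ℚ → ℕ → ℚ
q ^ℚ zero = 1ℚ
q ^ℚ suc e = q ℚ.* (q ^ℚ e)

ℕ→ℚ : ℕ → ℚ
ℕ→ℚ d = + d / 1

-- reciprocal of a natural number (only used at positive arguments; 0 ↦ 0)
inv : ℕ → ℚ
inv zero = 0ℚ
inv (suc d) = + 1 / suc d

sgn : ℕ → ℚ
sgn e = (ℚ.- 1ℚ) ^ℚ e

H : ℕ → ℕ → ℚ
H m n = sumℚ (map (λ i → inv (suc i ℕ.^ m)) (upTo n))

tuples : ℕ → ℕ → List (List ℕ)
tuples b zero = [] ∷ []
tuples b (suc ℓ) = concatMap (λ m → map (m ∷_) (tuples b ℓ)) (upTo (suc b))

weight : ℕ → List ℕ → ℕ
weight s [] = 0
weight s (m ∷ ms) = s ℕ.* m ℕ.+ weight (suc s) ms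

partitions : ℕ → List (List ℕ)
partitions ℓ = filterᵇ (λ ms → weight 1 ms ℕ.≡ᵇ ℓ) (tuples ℓ ℓ)

A : ℕ → ℕ → ℕ → ℕ → ℕ → ℚ
A λ' μ n k i =
  ℕ→ℚ λ' ℚ.* (H i k ℚ.+ sgn i ℚ.* H i (n ∸ k))
  ℚ.+ ℕ→ℚ μ ℚ.* (H i k ℚ.- H i (n ℕ.+ k))

prodTerm : ℕ → ℕ → ℕ → ℕ → ℕ → List ℕ → ℚ
prodTerm λ' μ n k s [] = 1ℚ
prodTerm λ' μ n k s (m ∷ ms) =
  ((A λ' μ n k s ^ℚ m) ℚ.* inv ((m !) ℕ.* (s ℕ.^ m)))
  ℚ.* prodTerm λ' μ n k (suc s) ms

Ω : ℕ → ℕ → ℕ → ℕ → ℕ → ℚ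
Ω ℓ λ' μ n k = ℕ→ℚ (ℓ !) ℚ.* sumℚ (map (prodTerm λ' μ n k 1) (partitions ℓ))

mainSum : ℕ → ℕ → ℕ → ℚ
mainSum λ' μ n = sumℚ (map term (upTo (suc n)))
  where
  term : ℕ → ℚ
  term k = sgn (k ℕ.* λ') ℚ.* (ℕ→ℚ (n C k) ^ℚ λ') ℚ.* (ℕ→ℚ ((n ℕ.+ k) C k) ^ℚ μ)
           ℚ.* Ω (λ' ∸ 1) λ' μ n k

-- The summands are, up to a common factor, the residues at x = −k (0 ≤ k ≤ n) of
--   R(x) = ∏_{j=1}^{n} (x − j)^μ / ∏_{j=0}^{n} (x + j)^λ,
-- and the hypothesis λ + (λ − μ) n > 1 says that R vanishes to order at least 2 at infinity, so the
-- residues sum to zero. Near −k write (x + k)^λ R(x) = S(t), t = x + k. The constant term S(0) carries the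
-- factor (−1)^{kλ} C(n,k)^λ C(n+k,k)^μ, and the logarithmic derivative S′/S has coefficients A_{i+1}, the
-- brackets in the definition of Ω; by the exponential formula the residue, the coefficient of t^{λ−1} in S,
-- is S(0) Ω_{λ−1} / (λ−1)!. The residue theorem is proved algebraically, by induction on the partial
-- fraction identity (a − b) / ((x − a)(x − b)) = 1 / (x − a) − 1 / (x − b), with all expansions formal
-- power series over ℚ.

module Submission where

open import Data.Bool using (Bool; true; false; T)
open import Data.Empty using (⊥-elim)
open import Data.Integer as ℤ using (+_)
import Data.Integer.Properties as ℤ
open import Data.Integer.Tactic.RingSolver using (solve-∀)
open import Data.List using (List; []; _∷_; _++_; map; replicate; length; concatMap; filterᵇ; applyUpTo; upTo)
import Data.List.Properties as List
open import Data.List.Relation.Unary.All as All using (All; []; _∷_)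
open import Data.List.Relation.Unary.All.Properties using (++⁺; ++⁻; replicate⁺)
open import Data.Nat as ℕ using (ℕ; zero; suc; _∸_; _!; _≤_; _≤ᵇ_)
open import Data.Nat.Combinatorics using (_C_; k![n∸k]!∣n!)
open import Data.Nat.Combinatorics.Specification using (nCk≡n!/k![n-k]!)
import Data.Nat.Coprimality as Coprime
open import Data.Nat.DivMod using (m/n*n≡m)
import Data.Nat.Properties as ℕ
open import Data.Product using (_,_; proj₁; proj₂)
open import Data.Rational as ℚ using (ℚ; 0ℚ; 1ℚ; _+_; _*_; _-_; -_; _≟_)
import Data.Rational.Properties as ℚ
open import Data.Rational.Solver using (module +-*-Solver)
import Data.Rational.Unnormalised as ℚᵘ
import Data.Rational.Unnormalised.Properties as ℚᵘ
open import Data.Sum using (_⊎_; inj₁; inj₂)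
open import Function using (_∘_)
open import Relation.Binary.PropositionalEquality
open import Relation.Nullary using (yes; no; ¬_; Dec)

open import Defs

open +-*-Solver
open ≡-Reasoning

-- Rational arithmetic

-- Total inverse; the junk value 0 ⁻¹ = 0 makes the laws for products and powers unconditional.
infix 21 _⁻¹
_⁻¹ : ℚ → ℚ
p ⁻¹ with p ≟ 0ℚ
... | yes _ = 0ℚ
... | no p≢0 = ℚ.1/_ p {{ℚ.≢-nonZero p≢0}}

*-inverseʳ′ : ∀ p → p ≢ 0ℚ → p * p ⁻¹ ≡ 1ℚ
*-inverseʳ′ p p≢0 with p ≟ 0ℚ
... | yes p≡0 = ⊥-elim (p≢0 p≡0)
... | no p≢0′ = ℚ.*-inverseʳ p {{ℚ.≢-nonZero p≢0′}}

*-cancelʳ′ : ∀ x y d → d ≢ 0ℚ → x * d ≡ y * d → x ≡ y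
*-cancelʳ′ x y d d≢0 eq = begin
  x                ≡⟨ sym (ℚ.*-identityʳ x) ⟩
  x * 1ℚ           ≡⟨ cong (x *_) (sym (*-inverseʳ′ d d≢0)) ⟩
  x * (d * d ⁻¹)   ≡⟨ sym (ℚ.*-assoc x d (d ⁻¹)) ⟩
  x * d * d ⁻¹     ≡⟨ cong (_* d ⁻¹) eq ⟩
  y * d * d ⁻¹     ≡⟨ ℚ.*-assoc y d (d ⁻¹) ⟩
  y * (d * d ⁻¹)   ≡⟨ cong (y *_) (*-inverseʳ′ d d≢0) ⟩
  y * 1ℚ           ≡⟨ ℚ.*-identityʳ y ⟩
  y                ∎

*≡0⇒≡0 : ∀ d x → d ≢ 0ℚ → d * x ≡ 0ℚ → x ≡ 0ℚ
*≡0⇒≡0 d x d≢0 eq = *-cancelʳ′ x 0ℚ d d≢0 (trans (ℚ.*-comm x d) (trans eq (sym (ℚ.*-zeroˡ d))))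

x-y≡0⇒x≡y : ∀ x y → x - y ≡ 0ℚ → x ≡ y
x-y≡0⇒x≡y x y eq = begin
  x             ≡⟨ solve 2 (λ x y → x := (x :- y) :+ y) refl x y ⟩
  (x - y) + y   ≡⟨ cong (_+ y) eq ⟩
  0ℚ + y        ≡⟨ ℚ.+-identityˡ y ⟩
  y             ∎

x≢y⇒x-y≢0 : ∀ x y → x ≢ y → x - y ≢ 0ℚ
x≢y⇒x-y≢0 x y x≢y = x≢y ∘ x-y≡0⇒x≡y x y

⁻¹-unique : ∀ p q → p * q ≡ 1ℚ → p ⁻¹ ≡ q
⁻¹-unique p q pq≡1 with p ≟ 0ℚ
... | yes refl = ⊥-elim (0≢1 (trans (sym (ℚ.*-zeroˡ q)) pq≡1))
  where
  0≢1 : 0ℚ ≢ 1ℚ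
  0≢1 ()
... | no p≢0 = *-cancelʳ′ _ q p p≢0
  (trans (ℚ.*-inverseˡ p {{ℚ.≢-nonZero p≢0}}) (trans (sym pq≡1) (ℚ.*-comm p q)))

⁻¹-distrib-* : ∀ p q → (p * q) ⁻¹ ≡ p ⁻¹ * q ⁻¹
⁻¹-distrib-* p q = cases (p ≟ 0ℚ) (q ≟ 0ℚ)
  where
  cases : Dec (p ≡ 0ℚ) → Dec (q ≡ 0ℚ) → (p * q) ⁻¹ ≡ p ⁻¹ * q ⁻¹
  cases (yes refl) _ = trans (cong _⁻¹ (ℚ.*-zeroˡ q)) (sym (ℚ.*-zeroˡ (q ⁻¹)))
  cases (no _) (yes refl) = trans (cong _⁻¹ (ℚ.*-zeroʳ p)) (sym (ℚ.*-zeroʳ (p ⁻¹)))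
  cases (no p≢0) (no q≢0) = ⁻¹-unique (p * q) (p ⁻¹ * q ⁻¹) (begin
    p * q * (p ⁻¹ * q ⁻¹)     ≡⟨ solve 4 (λ p q p′ q′ → p :* q :* (p′ :* q′) := (p :* p′) :* (q :* q′)) refl p q (p ⁻¹) (q ⁻¹) ⟩
    (p * p ⁻¹) * (q * q ⁻¹)   ≡⟨ cong₂ _*_ (*-inverseʳ′ p p≢0) (*-inverseʳ′ q q≢0) ⟩
    1ℚ                        ∎)

⁻¹-neg : ∀ p → (- p) ⁻¹ ≡ - p ⁻¹
⁻¹-neg p = cases (p ≟ 0ℚ)
  where
  cases : Dec (p ≡ 0ℚ) → (- p) ⁻¹ ≡ - p ⁻¹
  cases (yes refl) = refl
  cases (no p≢0) = ⁻¹-unique (- p) (- p ⁻¹)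
    (trans (solve 2 (λ p q → (:- p) :* (:- q) := p :* q) refl p (p ⁻¹)) (*-inverseʳ′ p p≢0))

1^ℚ≡1 : ∀ e → 1ℚ ^ℚ e ≡ 1ℚ
1^ℚ≡1 zero = refl
1^ℚ≡1 (suc e) = trans (ℚ.*-identityˡ _) (1^ℚ≡1 e)

^ℚ-distribˡ-+-* : ∀ q a b → q ^ℚ (a ℕ.+ b) ≡ q ^ℚ a * q ^ℚ b
^ℚ-distribˡ-+-* q zero b = sym (ℚ.*-identityˡ _)
^ℚ-distribˡ-+-* q (suc a) b = trans (cong (q *_) (^ℚ-distribˡ-+-* q a b)) (sym (ℚ.*-assoc q (q ^ℚ a) (q ^ℚ b)))

^ℚ-distribʳ-* : ∀ p q e → (p * q) ^ℚ e ≡ p ^ℚ e * q ^ℚ e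
^ℚ-distribʳ-* p q zero = refl
^ℚ-distribʳ-* p q (suc e) = trans (cong (p * q *_) (^ℚ-distribʳ-* p q e))
  (solve 4 (λ p q a b → p :* q :* (a :* b) := p :* a :* (q :* b)) refl p q (p ^ℚ e) (q ^ℚ e))

^ℚ-*-assoc : ∀ q a b → q ^ℚ (a ℕ.* b) ≡ (q ^ℚ a) ^ℚ b
^ℚ-*-assoc q zero b = sym (1^ℚ≡1 b)
^ℚ-*-assoc q (suc a) b = begin
  q ^ℚ (b ℕ.+ a ℕ.* b)       ≡⟨ ^ℚ-distribˡ-+-* q b (a ℕ.* b) ⟩
  q ^ℚ b * q ^ℚ (a ℕ.* b)    ≡⟨ cong (q ^ℚ b *_) (^ℚ-*-assoc q a b) ⟩
  q ^ℚ b * (q ^ℚ a) ^ℚ b     ≡⟨ sym (^ℚ-distribʳ-* q (q ^ℚ a) b) ⟩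
  (q * q ^ℚ a) ^ℚ b          ∎

⁻¹-^ℚ : ∀ q e → (q ^ℚ e) ⁻¹ ≡ q ⁻¹ ^ℚ e
⁻¹-^ℚ q zero = ⁻¹-unique 1ℚ 1ℚ refl
⁻¹-^ℚ q (suc e) = trans (⁻¹-distrib-* q (q ^ℚ e)) (cong (q ⁻¹ *_) (⁻¹-^ℚ q e))

sgn*sgn≡1 : ∀ e → sgn e * sgn e ≡ 1ℚ
sgn*sgn≡1 zero = refl
sgn*sgn≡1 (suc e) = trans (solve 1 (λ x → (:- con 1ℚ :* x) :* (:- con 1ℚ :* x) := x :* x) refl (sgn e)) (sgn*sgn≡1 e)

sgn⁻¹ : ∀ e → sgn e ⁻¹ ≡ sgn e
sgn⁻¹ e = ⁻¹-unique (sgn e) (sgn e) (sgn*sgn≡1 e)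

neg-^ℚ : ∀ r e → (- r) ^ℚ e ≡ sgn e * r ^ℚ e
neg-^ℚ r zero = refl
neg-^ℚ r (suc e) = trans (cong ((- r) *_) (neg-^ℚ r e))
  (solve 3 (λ r s x → (:- r) :* (s :* x) := ((:- con 1ℚ) :* s) :* (r :* x)) refl r (sgn e) (r ^ℚ e))

toℚᵘ-ℕ→ℚ : ∀ n → ℚ.toℚᵘ (ℕ→ℚ n) ≡ ℚᵘ.mkℚᵘ (+ n) 0
toℚᵘ-ℕ→ℚ n = cong ℚ.toℚᵘ (ℚ.normalize-coprime (Coprime.sym (Coprime.1-coprimeTo n)))

ℕ→ℚ-+ : ∀ m n → ℕ→ℚ (m ℕ.+ n) ≡ ℕ→ℚ m + ℕ→ℚ n
ℕ→ℚ-+ m n = ℚ.toℚᵘ-injective (ℚᵘ.≃-trans (ℚᵘ.≃-reflexive (toℚᵘ-ℕ→ℚ (m ℕ.+ n)))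
  (ℚᵘ.≃-trans (ℚᵘ.*≡* numerators)
  (ℚᵘ.≃-sym (ℚᵘ.≃-trans (ℚ.toℚᵘ-homo-+ (ℕ→ℚ m) (ℕ→ℚ n))
    (ℚᵘ.≃-reflexive (cong₂ ℚᵘ._+_ (toℚᵘ-ℕ→ℚ m) (toℚᵘ-ℕ→ℚ n)))))))
  where
  numerators : + (m ℕ.+ n) ℤ.* (+ 1 ℤ.* + 1) ≡ (+ m ℤ.* + 1 ℤ.+ + n ℤ.* + 1) ℤ.* + 1
  numerators = trans (ℤ.*-identityʳ (+ (m ℕ.+ n))) (trans (ℤ.pos-+ m n)
    (sym (trans (ℤ.*-identityʳ (+ m ℤ.* + 1 ℤ.+ + n ℤ.* + 1)) (cong₂ ℤ._+_ (ℤ.*-identityʳ (+ m)) (ℤ.*-identityʳ (+ n))))))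

ℕ→ℚ-* : ∀ m n → ℕ→ℚ (m ℕ.* n) ≡ ℕ→ℚ m * ℕ→ℚ n
ℕ→ℚ-* m n = ℚ.toℚᵘ-injective (ℚᵘ.≃-trans (ℚᵘ.≃-reflexive (toℚᵘ-ℕ→ℚ (m ℕ.* n)))
  (ℚᵘ.≃-trans (ℚᵘ.*≡* (cong (ℤ._* + 1) (ℤ.pos-* m n)))
  (ℚᵘ.≃-sym (ℚᵘ.≃-trans (ℚ.toℚᵘ-homo-* (ℕ→ℚ m) (ℕ→ℚ n))
    (ℚᵘ.≃-reflexive (cong₂ ℚᵘ._*_ (toℚᵘ-ℕ→ℚ m) (toℚᵘ-ℕ→ℚ n)))))))

ℕ→ℚ-^ : ∀ m e → ℕ→ℚ (m ℕ.^ e) ≡ ℕ→ℚ m ^ℚ e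
ℕ→ℚ-^ m zero = refl
ℕ→ℚ-^ m (suc e) = trans (ℕ→ℚ-* m (m ℕ.^ e)) (cong (ℕ→ℚ m *_) (ℕ→ℚ-^ m e))

ℕ→ℚ-∸ : ∀ m n → n ℕ.≤ m → ℕ→ℚ (m ∸ n) ≡ ℕ→ℚ m - ℕ→ℚ n
ℕ→ℚ-∸ m n n≤m = begin
  ℕ→ℚ (m ∸ n)                      ≡⟨ solve 2 (λ a b → a := a :+ b :- b) refl (ℕ→ℚ (m ∸ n)) (ℕ→ℚ n) ⟩
  ℕ→ℚ (m ∸ n) + ℕ→ℚ n - ℕ→ℚ n      ≡⟨ cong (_- ℕ→ℚ n) (sym (ℕ→ℚ-+ (m ∸ n) n)) ⟩
  ℕ→ℚ (m ∸ n ℕ.+ n) - ℕ→ℚ n        ≡⟨ cong (λ k → ℕ→ℚ k - ℕ→ℚ n) (ℕ.m∸n+n≡m n≤m) ⟩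
  ℕ→ℚ m - ℕ→ℚ n                    ∎

ℕ→ℚ-injective : ∀ m n → ℕ→ℚ m ≡ ℕ→ℚ n → m ≡ n
ℕ→ℚ-injective m n eq = ℤ.+-injective (begin
  + m                    ≡⟨ sym (cong ℚᵘ.↥_ (toℚᵘ-ℕ→ℚ m)) ⟩
  ℚᵘ.↥ ℚ.toℚᵘ (ℕ→ℚ m)    ≡⟨ cong (ℚᵘ.↥_ ∘ ℚ.toℚᵘ) eq ⟩
  ℚᵘ.↥ ℚ.toℚᵘ (ℕ→ℚ n)    ≡⟨ cong ℚᵘ.↥_ (toℚᵘ-ℕ→ℚ n) ⟩
  + n                    ∎)

ℕ→ℚ≢0 : ∀ n → 1 ℕ.≤ n → ℕ→ℚ n ≢ 0ℚ
ℕ→ℚ≢0 (suc n) _ eq with ℕ→ℚ-injective (suc n) 0 eq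
... | ()

ℕ→ℚ-!≢0 : ∀ m → ℕ→ℚ (m !) ≢ 0ℚ
ℕ→ℚ-!≢0 m = ℕ→ℚ≢0 (m !) (ℕ.1≤n! m)

inv≡ℕ→ℚ⁻¹ : ∀ d → inv d ≡ ℕ→ℚ d ⁻¹
inv≡ℕ→ℚ⁻¹ zero = refl
inv≡ℕ→ℚ⁻¹ (suc d) = sym (⁻¹-unique (ℕ→ℚ (suc d)) (inv (suc d)) (ℚ.toℚᵘ-injective
  (ℚᵘ.≃-trans (ℚ.toℚᵘ-homo-* (ℕ→ℚ (suc d)) (inv (suc d)))
  (ℚᵘ.≃-trans (ℚᵘ.≃-reflexive (cong₂ ℚᵘ._*_ (toℚᵘ-ℕ→ℚ (suc d)) (cong ℚ.toℚᵘ (ℚ.normalize-coprime (Coprime.1-coprimeTo (suc d))))))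
  (ℚᵘ.*≡* cross)))))
  where
  cross : (+ suc d ℤ.* + 1) ℤ.* + 1 ≡ + 1 ℤ.* + suc (d ℕ.+ 0)
  cross rewrite ℕ.+-identityʳ d = trans (ℤ.*-identityʳ (+ suc d ℤ.* + 1)) (trans (ℤ.*-identityʳ (+ suc d)) (sym (ℤ.*-identityˡ (+ suc d))))

ℕ→ℚ⁻¹-^ℚ : ∀ x i → ℕ→ℚ x ⁻¹ ^ℚ i ≡ inv (x ℕ.^ i)
ℕ→ℚ⁻¹-^ℚ x i = sym (trans (inv≡ℕ→ℚ⁻¹ (x ℕ.^ i)) (trans (cong _⁻¹ (ℕ→ℚ-^ x i)) (⁻¹-^ℚ (ℕ→ℚ x) i)))

ℕ→ℚ*inv≡1 : ∀ n → 1 ℕ.≤ n → ℕ→ℚ n * inv n ≡ 1ℚ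
ℕ→ℚ*inv≡1 n 1≤n = trans (cong (ℕ→ℚ n *_) (inv≡ℕ→ℚ⁻¹ n)) (*-inverseʳ′ (ℕ→ℚ n) (ℕ→ℚ≢0 n 1≤n))

inv-* : ∀ m n → inv (m ℕ.* n) ≡ inv m * inv n
inv-* m n = begin
  inv (m ℕ.* n)                ≡⟨ inv≡ℕ→ℚ⁻¹ (m ℕ.* n) ⟩
  ℕ→ℚ (m ℕ.* n) ⁻¹             ≡⟨ cong _⁻¹ (ℕ→ℚ-* m n) ⟩
  (ℕ→ℚ m * ℕ→ℚ n) ⁻¹           ≡⟨ ⁻¹-distrib-* (ℕ→ℚ m) (ℕ→ℚ n) ⟩
  ℕ→ℚ m ⁻¹ * ℕ→ℚ n ⁻¹          ≡⟨ sym (cong₂ _*_ (inv≡ℕ→ℚ⁻¹ m) (inv≡ℕ→ℚ⁻¹ n)) ⟩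
  inv m * inv n                ∎

-- Finite sums and products

guard : Bool → ℚ → ℚ
guard true x = x
guard false x = 0ℚ

∑ : (ℕ → ℚ) → ℕ → ℚ
∑ f zero = 0ℚ
∑ f (suc N) = f 0 + ∑ (f ∘ suc) N

∑-cong : ∀ N {f g} → (∀ i → i ℕ.< N → f i ≡ g i) → ∑ f N ≡ ∑ g N
∑-cong zero f≡g = refl
∑-cong (suc N) f≡g = cong₂ _+_ (f≡g 0 ℕ.z<s) (∑-cong N (λ i i<N → f≡g (suc i) (ℕ.s<s i<N)))

∑-zero : ∀ N f → (∀ i → i ℕ.< N → f i ≡ 0ℚ) → ∑ f N ≡ 0ℚ
∑-zero zero f f≡0 = refl
∑-zero (suc N) f f≡0 = cong₂ _+_ (f≡0 0 ℕ.z<s) (∑-zero N (f ∘ suc) (λ i i<N → f≡0 (suc i) (ℕ.s<s i<N)))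

∑-+ : ∀ N f g → ∑ (λ i → f i + g i) N ≡ ∑ f N + ∑ g N
∑-+ zero f g = refl
∑-+ (suc N) f g = trans (cong (λ z → f 0 + g 0 + z) (∑-+ N (f ∘ suc) (g ∘ suc)))
  (solve 4 (λ a b c d → a :+ b :+ (c :+ d) := a :+ c :+ (b :+ d)) refl (f 0) (g 0) (∑ (f ∘ suc) N) (∑ (g ∘ suc) N))

∑-*ˡ : ∀ N c f → ∑ (λ i → c * f i) N ≡ c * ∑ f N
∑-*ˡ zero c f = sym (ℚ.*-zeroʳ c)
∑-*ˡ (suc N) c f = trans (cong (λ z → c * f 0 + z) (∑-*ˡ N c (f ∘ suc))) (sym (ℚ.*-distribˡ-+ c _ _))

∑-neg : ∀ N f → ∑ (λ i → - f i) N ≡ - ∑ f N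
∑-neg zero f = refl
∑-neg (suc N) f = trans (cong (λ z → - f 0 + z) (∑-neg N (f ∘ suc))) (sym (ℚ.neg-distrib-+ (f 0) (∑ (f ∘ suc) N)))

∑-last : ∀ N f → ∑ f (suc N) ≡ ∑ f N + f N
∑-last zero f = trans (ℚ.+-identityʳ (f 0)) (sym (ℚ.+-identityˡ (f 0)))
∑-last (suc N) f = trans (cong (λ z → f 0 + z) (∑-last N (f ∘ suc))) (sym (ℚ.+-assoc (f 0) (∑ (f ∘ suc) N) (f (suc N))))

∑-split : ∀ M N f → ∑ f (M ℕ.+ N) ≡ ∑ f M + ∑ (λ i → f (M ℕ.+ i)) N
∑-split zero N f = sym (ℚ.+-identityˡ _)
∑-split (suc M) N f = trans (cong (λ z → f 0 + z) (∑-split M N (f ∘ suc)))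
  (sym (ℚ.+-assoc (f 0) (∑ (f ∘ suc) M) (∑ (λ i → f (suc M ℕ.+ i)) N)))

∑-comm : ∀ N M (f : ℕ → ℕ → ℚ) → ∑ (λ i → ∑ (f i) M) N ≡ ∑ (λ j → ∑ (λ i → f i j) N) M
∑-comm zero M f = sym (∑-zero M _ (λ _ _ → refl))
∑-comm (suc N) M f = begin
  ∑ (f 0) M + ∑ (λ i → ∑ (f (suc i)) M) N           ≡⟨ cong (λ z → ∑ (f 0) M + z) (∑-comm N M (f ∘ suc)) ⟩
  ∑ (f 0) M + ∑ (λ j → ∑ (λ i → f (suc i) j) N) M   ≡⟨ sym (∑-+ M _ _) ⟩
  ∑ (λ j → f 0 j + ∑ (λ i → f (suc i) j) N) M       ∎

∑-reverse : ∀ (f : ℕ → ℚ) k → ∑ (λ j → f (k ∸ j)) k ≡ ∑ (f ∘ suc) k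
∑-reverse f zero = refl
∑-reverse f (suc k) = begin
  f (suc k) + ∑ (λ j → f (k ∸ j)) k   ≡⟨ cong (λ z → f (suc k) + z) (∑-reverse f k) ⟩
  f (suc k) + ∑ (f ∘ suc) k           ≡⟨ ℚ.+-comm (f (suc k)) _ ⟩
  ∑ (f ∘ suc) k + f (suc k)           ≡⟨ sym (∑-last k (f ∘ suc)) ⟩
  ∑ (f ∘ suc) (suc k)                 ∎

module _ {A : Set} where

  ∑ₗ : (A → ℚ) → List A → ℚ
  ∑ₗ f xs = sumℚ (map f xs)

  ∑ₗ-cong : ∀ {f g : A → ℚ} xs → (∀ x → f x ≡ g x) → ∑ₗ f xs ≡ ∑ₗ g xs
  ∑ₗ-cong [] f≡g = refl
  ∑ₗ-cong (x ∷ xs) f≡g = cong₂ _+_ (f≡g x) (∑ₗ-cong xs f≡g)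

  ∑ₗ-zero : ∀ (f : A → ℚ) xs → (∀ x → f x ≡ 0ℚ) → ∑ₗ f xs ≡ 0ℚ
  ∑ₗ-zero f [] f≡0 = refl
  ∑ₗ-zero f (x ∷ xs) f≡0 = cong₂ _+_ (f≡0 x) (∑ₗ-zero f xs f≡0)

  ∑ₗ-*ˡ : ∀ c (f : A → ℚ) xs → ∑ₗ (λ x → c * f x) xs ≡ c * ∑ₗ f xs
  ∑ₗ-*ˡ c f [] = sym (ℚ.*-zeroʳ c)
  ∑ₗ-*ˡ c f (x ∷ xs) = trans (cong (λ z → c * f x + z) (∑ₗ-*ˡ c f xs)) (sym (ℚ.*-distribˡ-+ c (f x) _))

  ∑ₗ-+-* : ∀ (f g : A → ℚ) c xs → ∑ₗ (λ x → f x + c * g x) xs ≡ ∑ₗ f xs + c * ∑ₗ g xs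
  ∑ₗ-+-* f g c [] = solve 1 (λ c → con 0ℚ := con 0ℚ :+ c :* con 0ℚ) refl c
  ∑ₗ-+-* f g c (x ∷ xs) = trans (cong (λ z → f x + c * g x + z) (∑ₗ-+-* f g c xs))
    (solve 5 (λ a b c u v → a :+ c :* b :+ (u :+ c :* v) := a :+ u :+ c :* (b :+ v)) refl (f x) (g x) c (∑ₗ f xs) (∑ₗ g xs))

  ∑ₗ-sub : ∀ (f g : A → ℚ) xs → ∑ₗ (λ x → f x - g x) xs ≡ ∑ₗ f xs - ∑ₗ g xs
  ∑ₗ-sub f g [] = refl
  ∑ₗ-sub f g (x ∷ xs) = trans (cong (λ z → f x - g x + z) (∑ₗ-sub f g xs))
    (solve 4 (λ a b u v → a :- b :+ (u :- v) := a :+ u :- (b :+ v)) refl (f x) (g x) (∑ₗ f xs) (∑ₗ g xs))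

  ∑ₗ-++ : ∀ (f : A → ℚ) xs ys → ∑ₗ f (xs ++ ys) ≡ ∑ₗ f xs + ∑ₗ f ys
  ∑ₗ-++ f [] ys = sym (ℚ.+-identityˡ _)
  ∑ₗ-++ f (x ∷ xs) ys = trans (cong (λ z → f x + z) (∑ₗ-++ f xs ys)) (sym (ℚ.+-assoc (f x) (∑ₗ f xs) (∑ₗ f ys)))

  ∑ₗ-replicate : ∀ (f : A → ℚ) m x ys → ∑ₗ f (replicate m x ++ ys) ≡ ℕ→ℚ m * f x + ∑ₗ f ys
  ∑ₗ-replicate f zero x ys = sym (trans (cong (_+ ∑ₗ f ys) (ℚ.*-zeroˡ (f x))) (ℚ.+-identityˡ _))
  ∑ₗ-replicate f (suc m) x ys = begin
    f x + ∑ₗ f (replicate m x ++ ys)       ≡⟨ cong (λ z → f x + z) (∑ₗ-replicate f m x ys) ⟩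
    f x + (ℕ→ℚ m * f x + ∑ₗ f ys)          ≡⟨ solve 3 (λ m y s → y :+ (m :* y :+ s) := (con 1ℚ :+ m) :* y :+ s) refl (ℕ→ℚ m) (f x) (∑ₗ f ys) ⟩
    (1ℚ + ℕ→ℚ m) * f x + ∑ₗ f ys           ≡⟨ cong (λ z → z * f x + ∑ₗ f ys) (sym (ℕ→ℚ-+ 1 m)) ⟩
    ℕ→ℚ (suc m) * f x + ∑ₗ f ys            ∎

  ∑ₗ-guard : ∀ b (f : A → ℚ) xs → ∑ₗ (λ x → guard b (f x)) xs ≡ guard b (∑ₗ f xs)
  ∑ₗ-guard true f xs = refl
  ∑ₗ-guard false f xs = ∑ₗ-zero _ xs (λ _ → refl)

  ∑ₗ-filterᵇ : ∀ (p : A → Bool) (f : A → ℚ) xs → ∑ₗ f (filterᵇ p xs) ≡ ∑ₗ (λ x → guard (p x) (f x)) xs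
  ∑ₗ-filterᵇ p f [] = refl
  ∑ₗ-filterᵇ p f (x ∷ xs) with p x
  ... | true = cong (λ z → f x + z) (∑ₗ-filterᵇ p f xs)
  ... | false = trans (∑ₗ-filterᵇ p f xs) (sym (ℚ.+-identityˡ _))

module _ {A B : Set} where

  ∑ₗ-map : ∀ (f : B → ℚ) (g : A → B) xs → ∑ₗ f (map g xs) ≡ ∑ₗ (f ∘ g) xs
  ∑ₗ-map f g xs = cong sumℚ (sym (List.map-∘ xs))

  ∑ₗ-concatMap : ∀ (f : B → ℚ) (g : A → List B) xs → ∑ₗ f (concatMap g xs) ≡ ∑ₗ (∑ₗ f ∘ g) xs
  ∑ₗ-concatMap f g [] = refl
  ∑ₗ-concatMap f g (x ∷ xs) = trans (∑ₗ-++ f (g x) (concatMap g xs)) (cong (λ z → ∑ₗ f (g x) + z) (∑ₗ-concatMap f g xs))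

∑ₗ-applyUpTo : ∀ (f : ℕ → ℚ) g N → ∑ₗ f (applyUpTo g N) ≡ ∑ (f ∘ g) N
∑ₗ-applyUpTo f g zero = refl
∑ₗ-applyUpTo f g (suc N) = cong (λ z → f (g 0) + z) (∑ₗ-applyUpTo f (g ∘ suc) N)

∑ₗ-upTo : ∀ (f : ℕ → ℚ) N → ∑ₗ f (upTo N) ≡ ∑ f N
∑ₗ-upTo f = ∑ₗ-applyUpTo f (λ i → i)

guard-T : ∀ {b} x → T b → guard b x ≡ x
guard-T {true} x _ = refl

guard-¬T : ∀ {b} x → ¬ T b → guard b x ≡ 0ℚ
guard-¬T {true} x ¬t = ⊥-elim (¬t _)
guard-¬T {false} x _ = refl

guard-*ˡ : ∀ k b x → k * guard b x ≡ guard b (k * x)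
guard-*ˡ k true x = refl
guard-*ˡ k false x = ℚ.*-zeroʳ k

guard-∑ : ∀ b f N → guard b (∑ f N) ≡ ∑ (guard b ∘ f) N
guard-∑ true f N = refl
guard-∑ false f N = sym (∑-zero N _ (λ _ _ → refl))

guard-≤ᵇ-+ : ∀ p q L x → guard (p ≤ᵇ L) (guard (q ≤ᵇ L ∸ p) x) ≡ guard (p ℕ.+ q ≤ᵇ L) x
guard-≤ᵇ-+ p q L x with p ℕ.≤? L
... | no p≰L = trans (guard-¬T _ (p≰L ∘ ℕ.≤ᵇ⇒≤ p L)) (sym (guard-¬T x (p≰L ∘ ℕ.m+n≤o⇒m≤o p ∘ ℕ.≤ᵇ⇒≤ (p ℕ.+ q) L)))
... | yes p≤L with q ℕ.≤? L ∸ p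
...   | yes q≤L∸p = trans (guard-T _ (ℕ.≤⇒≤ᵇ p≤L)) (trans (guard-T x (ℕ.≤⇒≤ᵇ q≤L∸p))
                      (sym (guard-T x (ℕ.≤⇒≤ᵇ (subst (ℕ._≤ L) (ℕ.+-comm q p) (ℕ.m≤o∸n⇒m+n≤o q p≤L q≤L∸p))))))
...   | no q≰L∸p = trans (guard-T _ (ℕ.≤⇒≤ᵇ p≤L)) (trans (guard-¬T x (q≰L∸p ∘ ℕ.≤ᵇ⇒≤ q (L ∸ p)))
                      (sym (guard-¬T x (q≰L∸p ∘ ℕ.m+n≤o⇒m≤o∸n q ∘ subst (ℕ._≤ L) (ℕ.+-comm p q) ∘ ℕ.≤ᵇ⇒≤ (p ℕ.+ q) L))))

guard-≡ᵇ-+ : ∀ p w L c x → guard (p ℕ.+ w ℕ.≡ᵇ L) (c * x) ≡ guard (p ≤ᵇ L) (c * guard (w ℕ.≡ᵇ L ∸ p) x)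
guard-≡ᵇ-+ p w L c x with p ℕ.≤? L
... | no p≰L = trans (guard-¬T _ (p≰L ∘ λ t → subst (p ℕ.≤_) (ℕ.≡ᵇ⇒≡ _ L t) (ℕ.m≤m+n p w))) (sym (guard-¬T _ (p≰L ∘ ℕ.≤ᵇ⇒≤ p L)))
... | yes p≤L = begin
  guard (p ℕ.+ w ℕ.≡ᵇ L) (c * x)            ≡⟨ cong (λ t → guard t (c * x)) (T-injective (p ℕ.+ w ℕ.≡ᵇ L) (w ℕ.≡ᵇ L ∸ p) to from) ⟩
  guard (w ℕ.≡ᵇ L ∸ p) (c * x)              ≡⟨ sym (guard-*ˡ c (w ℕ.≡ᵇ L ∸ p) x) ⟩
  c * guard (w ℕ.≡ᵇ L ∸ p) x                ≡⟨ sym (guard-T _ (ℕ.≤⇒≤ᵇ p≤L)) ⟩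
  guard (p ≤ᵇ L) (c * guard (w ℕ.≡ᵇ L ∸ p) x) ∎
  where
  to : T (p ℕ.+ w ℕ.≡ᵇ L) → T (w ℕ.≡ᵇ L ∸ p)
  to t = ℕ.≡⇒≡ᵇ w (L ∸ p) (trans (sym (ℕ.m+n∸m≡n p w)) (cong (_∸ p) (ℕ.≡ᵇ⇒≡ _ L t)))
  from : T (w ℕ.≡ᵇ L ∸ p) → T (p ℕ.+ w ℕ.≡ᵇ L)
  from t = ℕ.≡⇒≡ᵇ (p ℕ.+ w) L (trans (cong (p ℕ.+_) (ℕ.≡ᵇ⇒≡ w _ t)) (ℕ.m+[n∸m]≡n p≤L))
  T-injective : ∀ a b → (T a → T b) → (T b → T a) → a ≡ b
  T-injective true true _ _ = refl
  T-injective true false f _ = ⊥-elim (f _)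
  T-injective false true _ g = ⊥-elim (g _)
  T-injective false false _ _ = refl

∑-guard-< : ∀ (f : ℕ → ℚ) L ℓ → L ℕ.≤ ℓ → ∑ (λ i → guard (suc i ≤ᵇ L) (f i)) ℓ ≡ ∑ f L
∑-guard-< f L ℓ L≤ℓ = begin
  ∑ h ℓ                                           ≡⟨ cong (∑ h) (sym (ℕ.m+[n∸m]≡n L≤ℓ)) ⟩
  ∑ h (L ℕ.+ (ℓ ∸ L))                             ≡⟨ ∑-split L (ℓ ∸ L) h ⟩
  ∑ h L + ∑ (λ i → h (L ℕ.+ i)) (ℓ ∸ L)
    ≡⟨ cong₂ _+_ (∑-cong L (λ i i<L → guard-T (f i) (ℕ.≤⇒≤ᵇ i<L)))
                 (∑-zero (ℓ ∸ L) _ (λ i _ → guard-¬T _ (λ t → ℕ.<⇒≱ (ℕ.s≤s (ℕ.m≤m+n L i)) (ℕ.≤ᵇ⇒≤ _ L t)))) ⟩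
  ∑ f L + 0ℚ                                      ≡⟨ ℚ.+-identityʳ _ ⟩
  ∑ f L                                           ∎
  where h = λ i → guard (suc i ≤ᵇ L) (f i)

∏ : (ℕ → ℚ) → ℕ → ℚ
∏ f zero = 1ℚ
∏ f (suc N) = f 0 * ∏ (f ∘ suc) N

∏-cong : ∀ N {f g} → (∀ i → i ℕ.< N → f i ≡ g i) → ∏ f N ≡ ∏ g N
∏-cong zero f≡g = refl
∏-cong (suc N) f≡g = cong₂ _*_ (f≡g 0 ℕ.z<s) (∏-cong N (λ i i<N → f≡g (suc i) (ℕ.s<s i<N)))

∏-last : ∀ N f → ∏ f (suc N) ≡ ∏ f N * f N
∏-last zero f = trans (ℚ.*-identityʳ (f 0)) (sym (ℚ.*-identityˡ (f 0)))
∏-last (suc N) f = trans (cong (f 0 *_) (∏-last N (f ∘ suc))) (sym (ℚ.*-assoc (f 0) (∏ (f ∘ suc) N) (f (suc N))))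

∏-split : ∀ M N f → ∏ f (M ℕ.+ N) ≡ ∏ f M * ∏ (λ i → f (M ℕ.+ i)) N
∏-split zero N f = sym (ℚ.*-identityˡ _)
∏-split (suc M) N f = trans (cong (f 0 *_) (∏-split M N (f ∘ suc)))
  (sym (ℚ.*-assoc (f 0) (∏ (f ∘ suc) M) (∏ (λ i → f (suc M ℕ.+ i)) N)))

∏-neg : ∀ N f → ∏ (λ i → - f i) N ≡ sgn N * ∏ f N
∏-neg zero f = refl
∏-neg (suc N) f = trans (cong (- f 0 *_) (∏-neg N (f ∘ suc)))
  (solve 3 (λ a s p → (:- a) :* (s :* p) := ((:- con 1ℚ) :* s) :* (a :* p)) refl (f 0) (sgn N) (∏ (f ∘ suc) N))

∏-⁻¹ : ∀ N f → ∏ (λ i → f i ⁻¹) N ≡ (∏ f N) ⁻¹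
∏-⁻¹ zero f = sym (⁻¹-unique 1ℚ 1ℚ refl)
∏-⁻¹ (suc N) f = trans (cong (f 0 ⁻¹ *_) (∏-⁻¹ N (f ∘ suc))) (sym (⁻¹-distrib-* (f 0) _))

∏-reverse : ∀ (f : ℕ → ℚ) k → ∏ (λ j → f (k ∸ j)) k ≡ ∏ (f ∘ suc) k
∏-reverse f zero = refl
∏-reverse f (suc k) = trans (cong (f (suc k) *_) (∏-reverse f k))
  (trans (ℚ.*-comm (f (suc k)) _) (sym (∏-last k (f ∘ suc))))

∏ₗ : (ℚ → ℚ) → List ℚ → ℚ
∏ₗ f [] = 1ℚ
∏ₗ f (x ∷ xs) = f x * ∏ₗ f xs

∏ₗ-replicate : ∀ f m x ys → ∏ₗ f (replicate m x ++ ys) ≡ f x ^ℚ m * ∏ₗ f ys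
∏ₗ-replicate f zero x ys = sym (ℚ.*-identityˡ _)
∏ₗ-replicate f (suc m) x ys = trans (cong (f x *_) (∏ₗ-replicate f m x ys)) (sym (ℚ.*-assoc (f x) (f x ^ℚ m) _))

k+[1+n∸k]≡1+n : ∀ k n → k ℕ.≤ n → k ℕ.+ suc (n ∸ k) ≡ suc n
k+[1+n∸k]≡1+n k n k≤n = trans (ℕ.+-suc k (n ∸ k)) (cong suc (ℕ.m+[n∸m]≡n k≤n))

∑-around : ∀ f k n → k ℕ.≤ n → ∑ f (suc n) ≡ ∑ f k + (f k + ∑ (λ t → f (k ℕ.+ suc t)) (n ∸ k))
∑-around f k n k≤n = begin
  ∑ f (suc n)                                                       ≡⟨ cong (∑ f) (sym (k+[1+n∸k]≡1+n k n k≤n)) ⟩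
  ∑ f (k ℕ.+ suc (n ∸ k))                                           ≡⟨ ∑-split k (suc (n ∸ k)) f ⟩
  ∑ f k + (f (k ℕ.+ 0) + ∑ (λ t → f (k ℕ.+ suc t)) (n ∸ k))        ≡⟨ cong (λ i → ∑ f k + (f i + ∑ (λ t → f (k ℕ.+ suc t)) (n ∸ k))) (ℕ.+-identityʳ k) ⟩
  ∑ f k + (f k + ∑ (λ t → f (k ℕ.+ suc t)) (n ∸ k))                ∎

∏-around : ∀ f k n → k ℕ.≤ n → ∏ f (suc n) ≡ ∏ f k * (f k * ∏ (λ t → f (k ℕ.+ suc t)) (n ∸ k))
∏-around f k n k≤n = begin
  ∏ f (suc n)                                                       ≡⟨ cong (∏ f) (sym (k+[1+n∸k]≡1+n k n k≤n)) ⟩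
  ∏ f (k ℕ.+ suc (n ∸ k))                                           ≡⟨ ∏-split k (suc (n ∸ k)) f ⟩
  ∏ f k * (f (k ℕ.+ 0) * ∏ (λ t → f (k ℕ.+ suc t)) (n ∸ k))        ≡⟨ cong (λ i → ∏ f k * (f i * ∏ (λ t → f (k ℕ.+ suc t)) (n ∸ k))) (ℕ.+-identityʳ k) ⟩
  ∏ f k * (f k * ∏ (λ t → f (k ℕ.+ suc t)) (n ∸ k))                ∎

∏-factorial : ∀ k n → ℕ→ℚ (k !) * ∏ (λ j → ℕ→ℚ (suc (k ℕ.+ j))) n ≡ ℕ→ℚ ((k ℕ.+ n) !)
∏-factorial k zero = trans (ℚ.*-identityʳ _) (cong (λ z → ℕ→ℚ (z !)) (sym (ℕ.+-identityʳ k)))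
∏-factorial k (suc n) = begin
  ℕ→ℚ (k !) * ∏ f (suc n)                  ≡⟨ cong (ℕ→ℚ (k !) *_) (∏-last n f) ⟩
  ℕ→ℚ (k !) * (∏ f n * f n)                ≡⟨ sym (ℚ.*-assoc (ℕ→ℚ (k !)) (∏ f n) (f n)) ⟩
  ℕ→ℚ (k !) * ∏ f n * f n                  ≡⟨ cong (_* f n) (∏-factorial k n) ⟩
  ℕ→ℚ ((k ℕ.+ n) !) * f n                  ≡⟨ ℚ.*-comm _ (f n) ⟩
  f n * ℕ→ℚ ((k ℕ.+ n) !)                  ≡⟨ sym (ℕ→ℚ-* (suc (k ℕ.+ n)) ((k ℕ.+ n) !)) ⟩
  ℕ→ℚ (suc (k ℕ.+ n) !)                    ≡⟨ cong (λ z → ℕ→ℚ (z !)) (sym (ℕ.+-suc k n)) ⟩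
  ℕ→ℚ ((k ℕ.+ suc n) !)                    ∎
  where f = λ j → ℕ→ℚ (suc (k ℕ.+ j))

∏-factorial₀ : ∀ n → ∏ (ℕ→ℚ ∘ suc) n ≡ ℕ→ℚ (n !)
∏-factorial₀ n = trans (sym (ℚ.*-identityˡ _)) (∏-factorial 0 n)

-- Formal power series and logarithmic derivatives

Series : Set
Series = ℕ → ℚ

one : Series
one zero = 1ℚ
one (suc _) = 0ℚ

shift : Series → Series
shift X zero = 0ℚ
shift X (suc i) = X i

mulLinear : ℚ → Series → Series
mulLinear d X i = d * X i + shift X i

-- (d + x)⁻¹ · X, obtained by solving (d + x) · Y = X coefficient by coefficient; meaningful for d ≢ 0.
divLinear : ℚ → Series → Series
divLinear d X zero = X 0 * d ⁻¹
divLinear d X (suc i) = (X (suc i) - divLinear d X i) * d ⁻¹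

shift-cong : ∀ {X Y} → X ≗ Y → shift X ≗ shift Y
shift-cong X≗Y zero = refl
shift-cong X≗Y (suc i) = X≗Y i

mulLinear-cong : ∀ d {X Y} → X ≗ Y → mulLinear d X ≗ mulLinear d Y
mulLinear-cong d X≗Y i = cong₂ _+_ (cong (d *_) (X≗Y i)) (shift-cong X≗Y i)

divLinear-cong : ∀ d {X Y} → X ≗ Y → divLinear d X ≗ divLinear d Y
divLinear-cong d X≗Y zero = cong (_* d ⁻¹) (X≗Y 0)
divLinear-cong d X≗Y (suc i) = cong (_* d ⁻¹) (cong₂ _-_ (X≗Y (suc i)) (divLinear-cong d X≗Y i))

mulLinear-zero : ∀ d {X} → X ≗ (λ _ → 0ℚ) → mulLinear d X ≗ (λ _ → 0ℚ)
mulLinear-zero d X≗0 zero = trans (cong (λ u → d * u + 0ℚ) (X≗0 0)) (solve 1 (λ d → d :* con 0ℚ :+ con 0ℚ := con 0ℚ) refl d)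
mulLinear-zero d X≗0 (suc i) = trans (cong₂ (λ u v → d * u + v) (X≗0 (suc i)) (X≗0 i)) (solve 1 (λ d → d :* con 0ℚ :+ con 0ℚ := con 0ℚ) refl d)

mulLinear-divLinear : ∀ d → d ≢ 0ℚ → ∀ X → mulLinear d (divLinear d X) ≗ X
mulLinear-divLinear d d≢0 X zero = begin
  d * (X 0 * d ⁻¹) + 0ℚ   ≡⟨ solve 3 (λ d x r → d :* (x :* r) :+ con 0ℚ := x :* (d :* r)) refl d (X 0) (d ⁻¹) ⟩
  X 0 * (d * d ⁻¹)        ≡⟨ cong (X 0 *_) (*-inverseʳ′ d d≢0) ⟩
  X 0 * 1ℚ                ≡⟨ ℚ.*-identityʳ _ ⟩
  X 0                     ∎
mulLinear-divLinear d d≢0 X (suc i) = begin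
  d * ((X (suc i) - Y) * d ⁻¹) + Y   ≡⟨ solve 4 (λ d x y r → d :* ((x :- y) :* r) :+ y := (x :- y) :* (d :* r) :+ y) refl d (X (suc i)) Y (d ⁻¹) ⟩
  (X (suc i) - Y) * (d * d ⁻¹) + Y   ≡⟨ cong (λ z → (X (suc i) - Y) * z + Y) (*-inverseʳ′ d d≢0) ⟩
  (X (suc i) - Y) * 1ℚ + Y           ≡⟨ solve 2 (λ x y → (x :- y) :* con 1ℚ :+ y := x) refl (X (suc i)) Y ⟩
  X (suc i)                          ∎
  where Y = divLinear d X i

divLinear-mulLinear : ∀ d → d ≢ 0ℚ → ∀ X → divLinear d (mulLinear d X) ≗ X
divLinear-mulLinear d d≢0 X zero = begin
  (d * X 0 + 0ℚ) * d ⁻¹   ≡⟨ solve 3 (λ d x r → (d :* x :+ con 0ℚ) :* r := x :* (d :* r)) refl d (X 0) (d ⁻¹) ⟩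
  X 0 * (d * d ⁻¹)        ≡⟨ cong (X 0 *_) (*-inverseʳ′ d d≢0) ⟩
  X 0 * 1ℚ                ≡⟨ ℚ.*-identityʳ _ ⟩
  X 0                     ∎
divLinear-mulLinear d d≢0 X (suc i) = begin
  (d * X (suc i) + X i - divLinear d (mulLinear d X) i) * d ⁻¹
      ≡⟨ cong (λ z → (d * X (suc i) + X i - z) * d ⁻¹) (divLinear-mulLinear d d≢0 X i) ⟩
  (d * X (suc i) + X i - X i) * d ⁻¹
      ≡⟨ solve 4 (λ d x y r → (d :* x :+ y :- y) :* r := x :* (d :* r)) refl d (X (suc i)) (X i) (d ⁻¹) ⟩
  X (suc i) * (d * d ⁻¹)  ≡⟨ cong (X (suc i) *_) (*-inverseʳ′ d d≢0) ⟩
  X (suc i) * 1ℚ          ≡⟨ ℚ.*-identityʳ _ ⟩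
  X (suc i)               ∎

mulLinear-injective : ∀ d → d ≢ 0ℚ → ∀ {X Y} → mulLinear d X ≗ mulLinear d Y → X ≗ Y
mulLinear-injective d d≢0 {X} {Y} eq i = begin
  X i                              ≡⟨ sym (divLinear-mulLinear d d≢0 X i) ⟩
  divLinear d (mulLinear d X) i    ≡⟨ divLinear-cong d eq i ⟩
  divLinear d (mulLinear d Y) i    ≡⟨ divLinear-mulLinear d d≢0 Y i ⟩
  Y i                              ∎

mulLinear-comm : ∀ d e X → mulLinear d (mulLinear e X) ≗ mulLinear e (mulLinear d X)
mulLinear-comm d e X zero = solve 3 (λ d e x → d :* (e :* x :+ con 0ℚ) :+ con 0ℚ := e :* (d :* x :+ con 0ℚ) :+ con 0ℚ) refl d e (X 0)
mulLinear-comm d e X (suc i) = solve 5 (λ d e x y z → d :* (e :* x :+ y) :+ (e :* y :+ z) := e :* (d :* x :+ y) :+ (d :* y :+ z))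
  refl d e (X (suc i)) (X i) (shift X i)

mulLinear-divLinear-comm : ∀ d e → e ≢ 0ℚ → ∀ X → mulLinear d (divLinear e X) ≗ divLinear e (mulLinear d X)
mulLinear-divLinear-comm d e e≢0 X = mulLinear-injective e e≢0 (λ i → begin
  mulLinear e (mulLinear d (divLinear e X)) i    ≡⟨ mulLinear-comm e d (divLinear e X) i ⟩
  mulLinear d (mulLinear e (divLinear e X)) i    ≡⟨ mulLinear-cong d (mulLinear-divLinear e e≢0 X) i ⟩
  mulLinear d X i                                ≡⟨ sym (mulLinear-divLinear e e≢0 (mulLinear d X) i) ⟩
  mulLinear e (divLinear e (mulLinear d X)) i    ∎)

divLinear-comm : ∀ d e → d ≢ 0ℚ → e ≢ 0ℚ → ∀ X → divLinear d (divLinear e X) ≗ divLinear e (divLinear d X)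
divLinear-comm d e d≢0 e≢0 X = mulLinear-injective d d≢0 (mulLinear-injective e e≢0 (λ i → begin
  mulLinear e (mulLinear d (divLinear d (divLinear e X))) i  ≡⟨ mulLinear-cong e (mulLinear-divLinear d d≢0 (divLinear e X)) i ⟩
  mulLinear e (divLinear e X) i                              ≡⟨ mulLinear-divLinear e e≢0 X i ⟩
  X i                                                        ≡⟨ sym (mulLinear-divLinear d d≢0 X i) ⟩
  mulLinear d (divLinear d X) i                              ≡⟨ sym (mulLinear-divLinear e e≢0 (mulLinear d (divLinear d X)) i) ⟩
  mulLinear e (divLinear e (mulLinear d (divLinear d X))) i  ≡⟨ sym (mulLinear-cong e (mulLinear-divLinear-comm d e e≢0 (divLinear d X)) i) ⟩
  mulLinear e (mulLinear d (divLinear e (divLinear d X))) i  ∎))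

-- Coefficients of (d + x)⁻¹.
recipCoeff : ℚ → ℕ → ℚ
recipCoeff d i = sgn i * d ⁻¹ ^ℚ suc i

recipCoeff-neg : ∀ x i → recipCoeff (- x) i ≡ - (x ⁻¹ ^ℚ suc i)
recipCoeff-neg x i = begin
  sgn i * (- x) ⁻¹ ^ℚ suc i              ≡⟨ cong (λ z → sgn i * z ^ℚ suc i) (⁻¹-neg x) ⟩
  sgn i * (- x ⁻¹) ^ℚ suc i              ≡⟨ cong (sgn i *_) (neg-^ℚ (x ⁻¹) (suc i)) ⟩
  sgn i * (sgn (suc i) * x ⁻¹ ^ℚ suc i)  ≡⟨ solve 2 (λ s y → s :* (((:- con 1ℚ) :* s) :* y) := :- ((s :* s) :* y)) refl (sgn i) (x ⁻¹ ^ℚ suc i) ⟩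
  - (sgn i * sgn i * x ⁻¹ ^ℚ suc i)      ≡⟨ cong (λ z → - (z * x ⁻¹ ^ℚ suc i)) (sgn*sgn≡1 i) ⟩
  - (1ℚ * x ⁻¹ ^ℚ suc i)                 ≡⟨ cong -_ (ℚ.*-identityˡ _) ⟩
  - (x ⁻¹ ^ℚ suc i)                      ∎

-- Coefficient of x^L in x · a · X.
xProduct : Series → Series → ℕ → ℚ
xProduct a X L = ∑ (λ i → a i * X (L ∸ suc i)) L

defect : Series → Series → Series
defect a X L = ℕ→ℚ L * X L - xProduct a X L

-- a is the logarithmic derivative of X: x X′ = x a X, coefficientwise L X_L = Σ_{i<L} a_i X_{L-1-i}.
IsLogDerivative : Series → Series → Set
IsLogDerivative a X = ∀ L → defect a X L ≡ 0ℚ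

defect-cong : ∀ a {X Y} → X ≗ Y → defect a X ≗ defect a Y
defect-cong a X≗Y L = cong₂ _-_ (cong (ℕ→ℚ L *_) (X≗Y L)) (∑-cong L (λ i _ → cong (a i *_) (X≗Y (L ∸ suc i))))

defect-congˡ : ∀ {a b} X → a ≗ b → defect a X ≗ defect b X
defect-congˡ X a≗b L = cong (λ z → ℕ→ℚ L * X L - z) (∑-cong L (λ i _ → cong (_* X (L ∸ suc i)) (a≗b i)))

isLogDerivative-congˡ : ∀ {a b} X → a ≗ b → IsLogDerivative a X → IsLogDerivative b X
isLogDerivative-congˡ X a≗b a↝X L = trans (sym (defect-congˡ X a≗b L)) (a↝X L)

defect-*ˡ : ∀ a k X L → defect a (λ i → k * X i) L ≡ k * defect a X L
defect-*ˡ a k X L = begin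
  ℕ→ℚ L * (k * X L) - ∑ (λ i → a i * (k * X (L ∸ suc i))) L
    ≡⟨ cong (λ z → ℕ→ℚ L * (k * X L) - z) (trans (∑-cong L (λ i _ → solve 3 (λ a k x → a :* (k :* x) := k :* (a :* x)) refl (a i) k (X (L ∸ suc i))))
                                            (∑-*ˡ L k (λ i → a i * X (L ∸ suc i)))) ⟩
  ℕ→ℚ L * (k * X L) - k * xProduct a X L
    ≡⟨ solve 4 (λ l k x r → l :* (k :* x) :- k :* r := k :* (l :* x :- r)) refl (ℕ→ℚ L) k (X L) (xProduct a X L) ⟩
  k * defect a X L ∎

-- (d + x)⁻¹ · (d + x) · X = X, read off at x^L.
∑-recipCoeff-mulLinear : ∀ d → d ≢ 0ℚ → ∀ X L → ∑ (λ i → recipCoeff d i * mulLinear d X (L ∸ i)) (suc L) ≡ X L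
∑-recipCoeff-mulLinear d d≢0 X zero = begin
  (1ℚ * (r * 1ℚ)) * (d * X 0 + 0ℚ) + 0ℚ
    ≡⟨ solve 3 (λ r d x → (con 1ℚ :* (r :* con 1ℚ)) :* (d :* x :+ con 0ℚ) :+ con 0ℚ := x :* (d :* r)) refl r d (X 0) ⟩
  X 0 * (d * r)  ≡⟨ cong (X 0 *_) (*-inverseʳ′ d d≢0) ⟩
  X 0 * 1ℚ       ≡⟨ ℚ.*-identityʳ _ ⟩
  X 0            ∎
  where r = d ⁻¹
∑-recipCoeff-mulLinear d d≢0 X (suc L) = begin
  recipCoeff d 0 * mulLinear d X (suc L) + ∑ (λ i → recipCoeff d (suc i) * mulLinear d X (L ∸ i)) (suc L)
    ≡⟨ cong (λ z → recipCoeff d 0 * mulLinear d X (suc L) + z) (trans (∑-cong (suc L) (λ i _ → step i)) (∑-*ˡ (suc L) (- r) term)) ⟩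
  recipCoeff d 0 * mulLinear d X (suc L) + (- r) * ∑ term (suc L)
    ≡⟨ cong (λ z → recipCoeff d 0 * mulLinear d X (suc L) + (- r) * z) (∑-recipCoeff-mulLinear d d≢0 X L) ⟩
  (1ℚ * (r * 1ℚ)) * (d * X (suc L) + X L) + (- r) * X L
    ≡⟨ solve 4 (λ r d x y → (con 1ℚ :* (r :* con 1ℚ)) :* (d :* x :+ y) :+ (:- r) :* y := x :* (d :* r)) refl r d (X (suc L)) (X L) ⟩
  X (suc L) * (d * r)  ≡⟨ cong (X (suc L) *_) (*-inverseʳ′ d d≢0) ⟩
  X (suc L) * 1ℚ       ≡⟨ ℚ.*-identityʳ _ ⟩
  X (suc L)            ∎
  where
  r = d ⁻¹
  term = λ i → recipCoeff d i * mulLinear d X (L ∸ i)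
  step : ∀ i → recipCoeff d (suc i) * mulLinear d X (L ∸ i) ≡ (- r) * term i
  step i = solve 4 (λ s r x y → ((:- con 1ℚ) :* s) :* (r :* x) :* y := (:- r) :* (s :* x :* y))
    refl (sgn i) r (r ^ℚ suc i) (mulLinear d X (L ∸ i))

xProduct-shift : ∀ b G L → ∑ (λ i → b i * shift G (L ∸ i)) (suc L) ≡ xProduct b G L
xProduct-shift b G L = begin
  ∑ (λ i → b i * shift G (L ∸ i)) (suc L)                 ≡⟨ ∑-last L (λ i → b i * shift G (L ∸ i)) ⟩
  ∑ (λ i → b i * shift G (L ∸ i)) L + b L * shift G (L ∸ L)
    ≡⟨ cong₂ _+_ (∑-cong L (λ i i<L → cong (λ z → b i * shift G z) (ℕ.+-∸-assoc 1 i<L))) (cong (λ z → b L * shift G z) (ℕ.n∸n≡0 L)) ⟩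
  xProduct b G L + b L * 0ℚ                               ≡⟨ solve 2 (λ x y → x :+ y :* con 0ℚ := x) refl (xProduct b G L) (b L) ⟩
  xProduct b G L                                          ∎

-- Multiplying by (d + x) adds its logarithmic derivative (d + x)⁻¹, even when the equation X′ = a X fails.
defect-mulLinear : ∀ b d → d ≢ 0ℚ → ∀ G → defect (λ i → b i + recipCoeff d i) (mulLinear d G) ≗ mulLinear d (defect b G)
defect-mulLinear b d d≢0 G zero =
  solve 2 (λ d g → con 0ℚ :* (d :* g :+ con 0ℚ) :- con 0ℚ := d :* (con 0ℚ :* g :- con 0ℚ) :+ con 0ℚ) refl d (G 0)
defect-mulLinear b d d≢0 G (suc L) = begin
  ℕ→ℚ (suc L) * Y (suc L) - xProduct a Y (suc L)
    ≡⟨ cong₂ (λ l z → l * Y (suc L) - z) (ℕ→ℚ-+ 1 L) xProduct-split ⟩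
  (1ℚ + ℕ→ℚ L) * (d * G (suc L) + G L) - (d * xProduct b G (suc L) + xProduct b G L + G L)
    ≡⟨ solve 6 (λ l d g₁ g₀ r₁ r₀ → (con 1ℚ :+ l) :* (d :* g₁ :+ g₀) :- (d :* r₁ :+ r₀ :+ g₀)
                                   := d :* ((con 1ℚ :+ l) :* g₁ :- r₁) :+ (l :* g₀ :- r₀))
         refl (ℕ→ℚ L) d (G (suc L)) (G L) (xProduct b G (suc L)) (xProduct b G L) ⟩
  d * ((1ℚ + ℕ→ℚ L) * G (suc L) - xProduct b G (suc L)) + defect b G L
    ≡⟨ cong (λ l → d * (l * G (suc L) - xProduct b G (suc L)) + defect b G L) (sym (ℕ→ℚ-+ 1 L)) ⟩
  mulLinear d (defect b G) (suc L) ∎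
  where
  a = λ i → b i + recipCoeff d i
  Y = mulLinear d G
  xProduct-split : xProduct a Y (suc L) ≡ d * xProduct b G (suc L) + xProduct b G L + G L
  xProduct-split = begin
    ∑ (λ i → a i * Y (L ∸ i)) (suc L)
      ≡⟨ trans (∑-cong (suc L) (λ i _ → ℚ.*-distribʳ-+ (Y (L ∸ i)) (b i) (recipCoeff d i)))
               (∑-+ (suc L) (λ i → b i * Y (L ∸ i)) (λ i → recipCoeff d i * Y (L ∸ i))) ⟩
    ∑ (λ i → b i * Y (L ∸ i)) (suc L) + ∑ (λ i → recipCoeff d i * Y (L ∸ i)) (suc L)
      ≡⟨ cong₂ _+_ (trans (∑-cong (suc L) (λ i _ → solve 4 (λ b d g s → b :* (d :* g :+ s) := d :* (b :* g) :+ b :* s) refl (b i) d (G (L ∸ i)) (shift G (L ∸ i))))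
                          (∑-+ (suc L) (λ i → d * (b i * G (L ∸ i))) (λ i → b i * shift G (L ∸ i))))
                   (∑-recipCoeff-mulLinear d d≢0 G L) ⟩
    ∑ (λ i → d * (b i * G (L ∸ i))) (suc L) + ∑ (λ i → b i * shift G (L ∸ i)) (suc L) + G L
      ≡⟨ cong (_+ G L) (cong₂ _+_ (∑-*ˡ (suc L) d (λ i → b i * G (L ∸ i))) (xProduct-shift b G L)) ⟩
    d * xProduct b G (suc L) + xProduct b G L + G L ∎

isLogDerivative-one : IsLogDerivative (λ _ → 0ℚ) one
isLogDerivative-one zero = refl
isLogDerivative-one (suc L) =
  trans (cong (λ z → ℕ→ℚ (suc L) * 0ℚ - z) (∑-zero (suc L) _ (λ i _ → ℚ.*-zeroˡ (one (L ∸ i)))))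
        (solve 1 (λ l → l :* con 0ℚ :- con 0ℚ := con 0ℚ) refl (ℕ→ℚ (suc L)))

isLogDerivative-mulLinear : ∀ b d → d ≢ 0ℚ → ∀ G → IsLogDerivative b G →
                            IsLogDerivative (λ i → b i + recipCoeff d i) (mulLinear d G)
isLogDerivative-mulLinear b d d≢0 G b↝G L =
  trans (defect-mulLinear b d d≢0 G L) (mulLinear-zero d b↝G L)

isLogDerivative-divLinear : ∀ a d → d ≢ 0ℚ → ∀ X → IsLogDerivative a X →
                            IsLogDerivative (λ i → a i - recipCoeff d i) (divLinear d X)
isLogDerivative-divLinear a d d≢0 X a↝X = mulLinear-injective d d≢0 (λ L → begin
  mulLinear d (defect b (divLinear d X)) L                    ≡⟨ sym (defect-mulLinear b d d≢0 (divLinear d X) L) ⟩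
  defect (λ i → b i + recipCoeff d i) (mulLinear d (divLinear d X)) L
    ≡⟨ defect-congˡ (mulLinear d (divLinear d X)) (λ i → solve 2 (λ x p → x :- p :+ p := x) refl (a i) (recipCoeff d i)) L ⟩
  defect a (mulLinear d (divLinear d X)) L                    ≡⟨ defect-cong a (mulLinear-divLinear d d≢0 X) L ⟩
  defect a X L                                                ≡⟨ a↝X L ⟩
  0ℚ                                                          ≡⟨ sym (mulLinear-zero d (λ _ → refl) L) ⟩
  mulLinear d (λ _ → 0ℚ) L                                    ∎)
  where b = λ i → a i - recipCoeff d i

isLogDerivative-unique : ∀ a X Y N → (∀ L → L ℕ.≤ N → defect a X L ≡ 0ℚ) → (∀ L → L ℕ.≤ N → defect a Y L ≡ 0ℚ) →
                         X 0 ≡ Y 0 → ∀ L → L ℕ.≤ N → X L ≡ Y L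
isLogDerivative-unique a X Y N a↝X a↝Y X₀≡Y₀ L L≤N = agree L L≤N L ℕ.≤-refl
  where
  agree : ∀ L → L ℕ.≤ N → ∀ j → j ℕ.≤ L → X j ≡ Y j
  agree zero _ zero _ = X₀≡Y₀
  agree (suc L) L<N j j≤1+L with ℕ.m≤n⇒m<n∨m≡n j≤1+L
  ... | inj₁ j<1+L = agree L (ℕ.<⇒≤ L<N) j (ℕ.≤-pred j<1+L)
  ... | inj₂ refl = *-cancelʳ′ (X (suc L)) (Y (suc L)) (ℕ→ℚ (suc L)) (ℕ→ℚ≢0 (suc L) (ℕ.s≤s ℕ.z≤n)) (begin
    X (suc L) * ℕ→ℚ (suc L)   ≡⟨ ℚ.*-comm (X (suc L)) _ ⟩
    ℕ→ℚ (suc L) * X (suc L)   ≡⟨ x-y≡0⇒x≡y _ _ (a↝X (suc L) L<N) ⟩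
    xProduct a X (suc L)      ≡⟨ ∑-cong (suc L) (λ i _ → cong (a i *_) (agree L (ℕ.<⇒≤ L<N) (L ∸ i) (ℕ.m∸n≤m L i))) ⟩
    xProduct a Y (suc L)      ≡⟨ sym (x-y≡0⇒x≡y _ _ (a↝Y (suc L) L<N)) ⟩
    ℕ→ℚ (suc L) * Y (suc L)   ≡⟨ ℚ.*-comm _ (Y (suc L)) ⟩
    Y (suc L) * ℕ→ℚ (suc L)   ∎)

-- Residues of rational functions

-- For the rational function ∏_{r ∈ R} (x − r) / ∏_{a ∈ D} (x − a) and a point c, write t = x − c:
-- poleOrder c D is the order of the pole at c, regularPart c D the series ∏_{a ∈ D, a ≢ c} (t + (c − a))⁻¹,
-- and mulZeros c R multiplies a series by ∏_{r ∈ R} (t + (c − r)); the residue at c is then the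
-- coefficient of t ^ (poleOrder c D − 1) in mulZeros c R (regularPart c D).

orderStep : ℚ → ℚ → ℕ → ℕ
orderStep c a e with c ≟ a
... | yes _ = suc e
... | no _ = e

poleOrder : ℚ → List ℚ → ℕ
poleOrder c [] = 0
poleOrder c (a ∷ D) = orderStep c a (poleOrder c D)

divFactor : ℚ → ℚ → Series → Series
divFactor c a X with c ≟ a
... | yes _ = X
... | no _ = divLinear (c - a) X

regularPart : ℚ → List ℚ → Series
regularPart c [] = one
regularPart c (a ∷ D) = divFactor c a (regularPart c D)

mulZeros : ℚ → List ℚ → Series → Series
mulZeros c [] X = X
mulZeros c (r ∷ R) X = mulLinear (c - r) (mulZeros c R X)

coeffBelow : ℕ → Series → ℚ
coeffBelow zero X = 0ℚ
coeffBelow (suc e) X = X e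

residue : ℚ → List ℚ → List ℚ → ℚ
residue c R D = coeffBelow (poleOrder c D) (mulZeros c R (regularPart c D))

mulZeros-cong : ∀ c R {X Y} → X ≗ Y → mulZeros c R X ≗ mulZeros c R Y
mulZeros-cong c [] X≗Y = X≗Y
mulZeros-cong c (r ∷ R) X≗Y = mulLinear-cong (c - r) (mulZeros-cong c R X≗Y)

mulLinear-mulZeros : ∀ c R d X → mulLinear d (mulZeros c R X) ≗ mulZeros c R (mulLinear d X)
mulLinear-mulZeros c [] d X i = refl
mulLinear-mulZeros c (r ∷ R) d X i =
  trans (mulLinear-comm d (c - r) (mulZeros c R X) i) (mulLinear-cong (c - r) (mulLinear-mulZeros c R d X) i)

coeffBelow-cong : ∀ e {X Y} → X ≗ Y → coeffBelow e X ≡ coeffBelow e Y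
coeffBelow-cong zero X≗Y = refl
coeffBelow-cong (suc e) X≗Y = X≗Y e

coeffBelow≡ : ∀ {e} X → 1 ℕ.≤ e → coeffBelow e X ≡ X (e ∸ 1)
coeffBelow≡ X (ℕ.s≤s _) = refl

-- (x − r) / (x − a) = 1 + (a − r) / (x − a)
residue-∷ : ∀ c r R a D → residue c (r ∷ R) (a ∷ D) ≡ residue c R D + (a - r) * residue c R (a ∷ D)
residue-∷ c r R a D with c ≟ a
... | yes refl = pole (poleOrder c D)
  where
  Y = mulZeros c R (regularPart c D)
  pole : ∀ e → coeffBelow (suc e) (mulLinear (c - r) Y) ≡ coeffBelow e Y + (c - r) * Y e
  pole zero = solve 1 (λ x → x :+ con 0ℚ := con 0ℚ :+ x) refl ((c - r) * Y 0)
  pole (suc e) = ℚ.+-comm ((c - r) * Y (suc e)) (Y e)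
... | no c≢a = begin
  coeffBelow e (mulLinear (c - r) W)                         ≡⟨ coeffBelow-cong e split ⟩
  coeffBelow e (λ i → mulZeros c R Z i + (a - r) * W i)      ≡⟨ coeffBelow-+-* e ⟩
  coeffBelow e (mulZeros c R Z) + (a - r) * coeffBelow e W   ∎
  where
  e = poleOrder c D
  Z = regularPart c D
  W = mulZeros c R (divLinear (c - a) Z)
  split : ∀ i → mulLinear (c - r) W i ≡ mulZeros c R Z i + (a - r) * W i
  split i = begin
    (c - r) * W i + shift W i                     ≡⟨ solve 5 (λ c r a w s → (c :- r) :* w :+ s := (c :- a) :* w :+ s :+ (a :- r) :* w) refl c r a (W i) (shift W i) ⟩
    mulLinear (c - a) W i + (a - r) * W i         ≡⟨ cong (_+ (a - r) * W i) (mulLinear-mulZeros c R (c - a) (divLinear (c - a) Z) i) ⟩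
    mulZeros c R (mulLinear (c - a) (divLinear (c - a) Z)) i + (a - r) * W i
      ≡⟨ cong (_+ (a - r) * W i) (mulZeros-cong c R (mulLinear-divLinear (c - a) (x≢y⇒x-y≢0 c a c≢a) Z) i) ⟩
    mulZeros c R Z i + (a - r) * W i              ∎
  coeffBelow-+-* : ∀ e → coeffBelow e (λ i → mulZeros c R Z i + (a - r) * W i) ≡ coeffBelow e (mulZeros c R Z) + (a - r) * coeffBelow e W
  coeffBelow-+-* zero = solve 1 (λ k → con 0ℚ := con 0ℚ :+ k :* con 0ℚ) refl (a - r)
  coeffBelow-+-* (suc e) = refl

divFactor-cong : ∀ c a {X Y} → X ≗ Y → divFactor c a X ≗ divFactor c a Y
divFactor-cong c a X≗Y with c ≟ a
... | yes _ = X≗Y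
... | no _ = divLinear-cong (c - a) X≗Y

divFactor-comm : ∀ c a b X → divFactor c a (divFactor c b X) ≗ divFactor c b (divFactor c a X)
divFactor-comm c a b X with c ≟ a | c ≟ b
... | yes _ | yes _ = λ _ → refl
... | yes _ | no _ = λ _ → refl
... | no _ | yes _ = λ _ → refl
... | no c≢a | no c≢b = divLinear-comm (c - a) (c - b) (x≢y⇒x-y≢0 c a c≢a) (x≢y⇒x-y≢0 c b c≢b) X

poleOrder-swap : ∀ c D₁ a D₂ → poleOrder c (D₁ ++ a ∷ D₂) ≡ poleOrder c (a ∷ D₁ ++ D₂)
poleOrder-swap c [] a D₂ = refl
poleOrder-swap c (b ∷ D₁) a D₂ = trans (cong (orderStep c b) (poleOrder-swap c D₁ a D₂)) (comm (poleOrder c (D₁ ++ D₂)))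
  where
  comm : ∀ e → orderStep c b (orderStep c a e) ≡ orderStep c a (orderStep c b e)
  comm e with c ≟ a | c ≟ b
  ... | yes _ | yes _ = refl
  ... | yes _ | no _ = refl
  ... | no _ | yes _ = refl
  ... | no _ | no _ = refl

regularPart-swap : ∀ c D₁ a D₂ → regularPart c (D₁ ++ a ∷ D₂) ≗ regularPart c (a ∷ D₁ ++ D₂)
regularPart-swap c [] a D₂ = λ _ → refl
regularPart-swap c (b ∷ D₁) a D₂ i =
  trans (divFactor-cong c b (regularPart-swap c D₁ a D₂) i) (divFactor-comm c b a (regularPart c (D₁ ++ D₂)) i)

residue-swap : ∀ c R D₁ a D₂ → residue c R (D₁ ++ a ∷ D₂) ≡ residue c R (a ∷ D₁ ++ D₂)
residue-swap c R D₁ a D₂ = trans (cong (λ e → coeffBelow e (mulZeros c R (regularPart c (D₁ ++ a ∷ D₂)))) (poleOrder-swap c D₁ a D₂))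
  (coeffBelow-cong (poleOrder c (a ∷ D₁ ++ D₂)) (mulZeros-cong c R (regularPart-swap c D₁ a D₂)))

module _ (c a : ℚ) where

  poleOrder-replicate : ∀ {D} → c ≡ a → All (_≡ a) D → poleOrder c D ≡ length D
  poleOrder-replicate c≡a [] = refl
  poleOrder-replicate {b ∷ D} c≡a (b≡a ∷ D≡a) with c ≟ b
  ... | yes _ = cong suc (poleOrder-replicate c≡a D≡a)
  ... | no c≢b = ⊥-elim (c≢b (trans c≡a (sym b≡a)))

  regularPart-replicate : ∀ {D} → c ≡ a → All (_≡ a) D → regularPart c D ≗ one
  regularPart-replicate c≡a [] = λ _ → refl
  regularPart-replicate {b ∷ D} c≡a (b≡a ∷ D≡a) with c ≟ b
  ... | yes _ = regularPart-replicate c≡a D≡a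
  ... | no c≢b = ⊥-elim (c≢b (trans c≡a (sym b≡a)))

  poleOrder-absent : ∀ {D} → c ≢ a → All (_≡ a) D → poleOrder c D ≡ 0
  poleOrder-absent c≢a [] = refl
  poleOrder-absent {b ∷ D} c≢a (b≡a ∷ D≡a) with c ≟ b
  ... | yes c≡b = ⊥-elim (c≢a (trans c≡b b≡a))
  ... | no _ = poleOrder-absent c≢a D≡a

  residue-power : ∀ D → All (_≡ a) D → residue c [] (a ∷ a ∷ D) ≡ 0ℚ
  residue-power D D≡a = cases (c ≟ a)
    where
    E = a ∷ a ∷ D
    E≡a : All (_≡ a) E
    E≡a = refl ∷ refl ∷ D≡a
    cases : Dec (c ≡ a) → residue c [] E ≡ 0ℚ
    cases (yes c≡a) = trans (cong (λ e → coeffBelow e (regularPart c E)) (poleOrder-replicate c≡a E≡a))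
                            (coeffBelow-cong (length E) (regularPart-replicate c≡a E≡a))
    cases (no c≢a) = cong (λ e → coeffBelow e (regularPart c E)) (poleOrder-absent c≢a E≡a)

-- Partial fractions: (a − b) / ((x − a)(x − b)) = 1 / (x − a) − 1 / (x − b).
residue-difference : ∀ c a b D₁ D₂ →
  (a - b) * residue c [] (a ∷ D₁ ++ b ∷ D₂) ≡ residue c [] (a ∷ D₁ ++ D₂) - residue c [] (D₁ ++ b ∷ D₂)
residue-difference c a b D₁ D₂ = begin
  (a - b) * X                            ≡⟨ solve 2 (λ y x → x := y :+ x :- y) refl Y ((a - b) * X) ⟩
  Y + (a - b) * X - Y                    ≡⟨ cong (_- Y) (sym (residue-∷ c b [] a (D₁ ++ b ∷ D₂))) ⟩
  residue c (b ∷ []) (a ∷ D₁ ++ b ∷ D₂) - Y   ≡⟨ cong (_- Y) (residue-swap c (b ∷ []) (a ∷ D₁) b D₂) ⟩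
  residue c (b ∷ []) (b ∷ a ∷ D₁ ++ D₂) - Y   ≡⟨ cong (_- Y) (residue-∷ c b [] b (a ∷ D₁ ++ D₂)) ⟩
  Z + (b - b) * W - Y                    ≡⟨ solve 4 (λ z b w y → z :+ (b :- b) :* w :- y := z :- y) refl Z b W Y ⟩
  Z - Y                                  ∎
  where
  X = residue c [] (a ∷ D₁ ++ b ∷ D₂)
  Y = residue c [] (D₁ ++ b ∷ D₂)
  Z = residue c [] (a ∷ D₁ ++ D₂)
  W = residue c [] (b ∷ a ∷ D₁ ++ D₂)

data AllEqualOrSplit (a : ℚ) (D : List ℚ) : Set where
  allEqual : All (_≡ a) D → AllEqualOrSplit a D
  split : ∀ D₁ b D₂ → b ≢ a → D ≡ D₁ ++ b ∷ D₂ → AllEqualOrSplit a D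

allEqualOrSplit : ∀ a D → AllEqualOrSplit a D
allEqualOrSplit a [] = allEqual []
allEqualOrSplit a (b ∷ D) with b ≟ a | allEqualOrSplit a D
... | no b≢a | _ = split [] b D b≢a refl
... | yes b≡a | allEqual D≡a = allEqual (b≡a ∷ D≡a)
... | yes _ | split D₁ c D₂ c≢a refl = split (b ∷ D₁) c D₂ c≢a refl

module _ (N : List ℚ) where

  totalResidue : List ℚ → List ℚ → ℚ
  totalResidue R D = ∑ₗ (λ c → residue c R D) N

  -- Every pole a is listed exactly once in N, phrased as: the residues of (x − a)⁻¹ over N sum to 1.
  Covers : List ℚ → Set
  Covers D = All (λ a → totalResidue [] (a ∷ []) ≡ 1ℚ) D

  totalResidue-difference : ∀ a b D₁ D₂ →
    (a - b) * totalResidue [] (a ∷ D₁ ++ b ∷ D₂) ≡ totalResidue [] (a ∷ D₁ ++ D₂) - totalResidue [] (D₁ ++ b ∷ D₂)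
  totalResidue-difference a b D₁ D₂ =
    trans (sym (∑ₗ-*ˡ (a - b) _ N)) (trans (∑ₗ-cong N (λ c → residue-difference c a b D₁ D₂)) (∑ₗ-sub _ _ N))

  totalResidue-poles : ∀ m D → length D ≡ 2 ℕ.+ m → Covers D → totalResidue [] D ≡ 0ℚ
  totalResidue-equal : ∀ m E₁ E₂ → length E₁ ≡ suc m → length E₂ ≡ suc m → Covers E₁ → Covers E₂ →
                       totalResidue [] E₁ ≡ totalResidue [] E₂

  totalResidue-poles m (a ∷ D) len cov with allEqualOrSplit a D
  ... | allEqual D≡a = powerCase D len D≡a
    where
    powerCase : ∀ D → length (a ∷ D) ≡ 2 ℕ.+ m → All (_≡ a) D → totalResidue [] (a ∷ D) ≡ 0ℚ
    powerCase (b ∷ D) _ (refl ∷ D≡a) = ∑ₗ-zero _ N (λ c → residue-power c a D D≡a)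
  totalResidue-poles m (a ∷ D) len (cov-a ∷ cov) | split D₁ b D₂ b≢a refl =
    *≡0⇒≡0 (a - b) _ (x≢y⇒x-y≢0 a b (b≢a ∘ sym)) (begin
      (a - b) * totalResidue [] (a ∷ D₁ ++ b ∷ D₂)                          ≡⟨ totalResidue-difference a b D₁ D₂ ⟩
      totalResidue [] (a ∷ D₁ ++ D₂) - totalResidue [] (D₁ ++ b ∷ D₂)       ≡⟨ cong (_- totalResidue [] (D₁ ++ b ∷ D₂)) same ⟩
      totalResidue [] (D₁ ++ b ∷ D₂) - totalResidue [] (D₁ ++ b ∷ D₂)       ≡⟨ ℚ.+-inverseʳ (totalResidue [] (D₁ ++ b ∷ D₂)) ⟩
      0ℚ                                                                    ∎)
    where
    cov₁ = ++⁻ D₁ cov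
    same = totalResidue-equal m (a ∷ D₁ ++ D₂) (D₁ ++ b ∷ D₂)
      (cong suc (ℕ.suc-injective (trans (sym (List.length-++-sucʳ D₁ b D₂)) (ℕ.suc-injective len))))
      (ℕ.suc-injective len)
      (cov-a ∷ ++⁺ (proj₁ cov₁) (All.tail (proj₂ cov₁))) cov

  totalResidue-equal zero (x ∷ []) (y ∷ []) _ _ (cov-x ∷ []) (cov-y ∷ []) = trans cov-x (sym cov-y)
  totalResidue-equal (suc m) E₁ E₂ len₁ len₂ cov₁ cov₂ =
    trans (totalResidue-poles m E₁ len₁ cov₁) (sym (totalResidue-poles m E₂ len₂ cov₂))

  totalResidue≡0 : ∀ R D → length R ℕ.+ 2 ℕ.≤ length D → Covers D → totalResidue R D ≡ 0ℚ
  totalResidue≡0 [] D len cov with ℕ.m≤n⇒∃[o]m+o≡n len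
  ... | m , len≡ = totalResidue-poles m D (sym len≡) cov
  totalResidue≡0 (r ∷ R) (a ∷ D) (ℕ.s≤s len) (cov-a ∷ cov) = begin
    totalResidue (r ∷ R) (a ∷ D)                                ≡⟨ ∑ₗ-cong N (λ c → residue-∷ c r R a D) ⟩
    ∑ₗ (λ c → residue c R D + (a - r) * residue c R (a ∷ D)) N  ≡⟨ ∑ₗ-+-* _ _ (a - r) N ⟩
    totalResidue R D + (a - r) * totalResidue R (a ∷ D)
      ≡⟨ cong₂ (λ x y → x + (a - r) * y) (totalResidue≡0 R D len cov) (totalResidue≡0 R (a ∷ D) (ℕ.m≤n⇒m≤1+n len) (cov-a ∷ cov)) ⟩
    0ℚ + (a - r) * 0ℚ                                           ≡⟨ solve 1 (λ k → con 0ℚ :+ k :* con 0ℚ := con 0ℚ) refl (a - r) ⟩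
    0ℚ                                                          ∎

poleFactor : ℚ → ℚ → ℚ
poleFactor c a with c ≟ a
... | yes _ = 1ℚ
... | no _ = (c - a) ⁻¹

poleCoeff : ℚ → ℚ → ℕ → ℚ
poleCoeff c a i with c ≟ a
... | yes _ = 0ℚ
... | no _ = recipCoeff (c - a) i

mulZeros-0 : ∀ c R X → mulZeros c R X 0 ≡ ∏ₗ (λ r → c - r) R * X 0
mulZeros-0 c [] X = sym (ℚ.*-identityˡ _)
mulZeros-0 c (r ∷ R) X = trans (ℚ.+-identityʳ _) (trans (cong ((c - r) *_) (mulZeros-0 c R X)) (sym (ℚ.*-assoc (c - r) _ _)))

regularPart-0 : ∀ c D → regularPart c D 0 ≡ ∏ₗ (poleFactor c) D
regularPart-0 c [] = refl
regularPart-0 c (a ∷ D) with c ≟ a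
... | yes _ = trans (regularPart-0 c D) (sym (ℚ.*-identityˡ _))
... | no _ = trans (cong (_* (c - a) ⁻¹) (regularPart-0 c D)) (ℚ.*-comm (∏ₗ (poleFactor c) D) ((c - a) ⁻¹))

isLogDerivative-regularPart : ∀ c D → IsLogDerivative (λ i → - ∑ₗ (λ a → poleCoeff c a i) D) (regularPart c D)
isLogDerivative-regularPart c [] = isLogDerivative-one
isLogDerivative-regularPart c (a ∷ D) with c ≟ a
... | yes _ = isLogDerivative-congˡ (regularPart c D) (λ i → cong -_ (sym (ℚ.+-identityˡ (∑ₗ (λ a → poleCoeff c a i) D))))
  (isLogDerivative-regularPart c D)
... | no c≢a = isLogDerivative-congˡ (divLinear (c - a) (regularPart c D))
  (λ i → solve 2 (λ s p → (:- s) :- p := :- (p :+ s)) refl (∑ₗ (λ a → poleCoeff c a i) D) (recipCoeff (c - a) i))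
  (isLogDerivative-divLinear (λ i → - ∑ₗ (λ a → poleCoeff c a i) D) (c - a) (x≢y⇒x-y≢0 c a c≢a) (regularPart c D) (isLogDerivative-regularPart c D))

isLogDerivative-mulZeros : ∀ c R {b} X → All (c ≢_) R → IsLogDerivative b X →
                           IsLogDerivative (λ i → b i + ∑ₗ (λ r → recipCoeff (c - r) i) R) (mulZeros c R X)
isLogDerivative-mulZeros c [] {b} X [] b↝X = isLogDerivative-congˡ X (λ i → sym (ℚ.+-identityʳ (b i))) b↝X
isLogDerivative-mulZeros c (r ∷ R) {b} X (c≢r ∷ c≢R) b↝X = isLogDerivative-congˡ (mulZeros c (r ∷ R) X)
  (λ i → solve 3 (λ b s p → b :+ s :+ p := b :+ (p :+ s)) refl (b i) (∑ₗ (λ r → recipCoeff (c - r) i) R) (recipCoeff (c - r) i))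
  (isLogDerivative-mulLinear (λ i → b i + ∑ₗ (λ r → recipCoeff (c - r) i) R) (c - r) (x≢y⇒x-y≢0 c r c≢r) (mulZeros c R X)
    (isLogDerivative-mulZeros c R {b} X c≢R b↝X))

poleFactor-≡ : ∀ c a → c ≡ a → poleFactor c a ≡ 1ℚ
poleFactor-≡ c a c≡a with c ≟ a
... | yes _ = refl
... | no c≢a = ⊥-elim (c≢a c≡a)

poleFactor-≢ : ∀ c a → c ≢ a → poleFactor c a ≡ (c - a) ⁻¹
poleFactor-≢ c a c≢a with c ≟ a
... | yes c≡a = ⊥-elim (c≢a c≡a)
... | no _ = refl

poleCoeff-≡ : ∀ c a i → c ≡ a → poleCoeff c a i ≡ 0ℚ
poleCoeff-≡ c a i c≡a with c ≟ a
... | yes _ = refl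
... | no c≢a = ⊥-elim (c≢a c≡a)

poleCoeff-≢ : ∀ c a i → c ≢ a → poleCoeff c a i ≡ recipCoeff (c - a) i
poleCoeff-≢ c a i c≢a with c ≟ a
... | yes c≡a = ⊥-elim (c≢a c≡a)
... | no _ = refl

-- The exponential formula

b<s+s*b : ∀ s {b} → 1 ℕ.≤ s → b ℕ.< s ℕ.+ s ℕ.* b
b<s+s*b (suc s) {b} _ = ℕ.s≤s (ℕ.≤-trans (ℕ.m≤m+n b (s ℕ.* b)) (ℕ.m≤n+m (b ℕ.+ s ℕ.* b) s))

-- The coefficients of ∏_{s ≥ 1} exp(α_s x^s / s), with each exponential truncated after its b-th term.
module ExponentialFormula (α : ℕ → ℚ) (b : ℕ) where

  expCoeff : ℕ → ℕ → ℚ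
  expCoeff s m = α s ^ℚ m * inv (m ! ℕ.* s ℕ.^ m)

  -- partitionSum s r L: coefficient of x^L in the product of the factors s, s + 1, …, s + r − 1.
  partitionSum : ℕ → ℕ → ℕ → ℚ
  partitionSum s zero L = guard (0 ℕ.≡ᵇ L) 1ℚ
  partitionSum s (suc r) L = ∑ (λ m → guard (s ℕ.* m ≤ᵇ L) (expCoeff s m * partitionSum (suc s) r (L ∸ s ℕ.* m))) (suc b)

  -- x d/dx exp(α_s x^s / s) = α_s x^s exp(α_s x^s / s)
  expCoeff-suc : ∀ s → 1 ℕ.≤ s → ∀ m → ℕ→ℚ (s ℕ.* suc m) * expCoeff s (suc m) ≡ α s * expCoeff s m
  expCoeff-suc s 1≤s m = begin
    ℕ→ℚ (s ℕ.* suc m) * (a * a ^ℚ m * inv ((suc m ℕ.* m !) ℕ.* (s ℕ.* s ℕ.^ m)))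
      ≡⟨ cong₂ (λ x y → x * (a * a ^ℚ m * y)) (ℕ→ℚ-* s (suc m))
               (trans (inv-* (suc m ℕ.* m !) (s ℕ.* s ℕ.^ m)) (cong₂ _*_ (inv-* (suc m) (m !)) (inv-* s (s ℕ.^ m)))) ⟩
    (S * M) * (a * a ^ℚ m * ((inv (suc m) * inv (m !)) * (inv s * inv (s ℕ.^ m))))
      ≡⟨ solve 8 (λ S M a aᵐ M′ F′ S′ P′ → (S :* M) :* (a :* aᵐ :* ((M′ :* F′) :* (S′ :* P′)))
                                          := a :* (aᵐ :* (F′ :* P′)) :* ((M :* M′) :* (S :* S′)))
           refl S M a (a ^ℚ m) (inv (suc m)) (inv (m !)) (inv s) (inv (s ℕ.^ m)) ⟩
    a * (a ^ℚ m * (inv (m !) * inv (s ℕ.^ m))) * ((M * inv (suc m)) * (S * inv s))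
      ≡⟨ cong₂ (λ x y → a * (a ^ℚ m * x) * y) (sym (inv-* (m !) (s ℕ.^ m)))
               (cong₂ _*_ (ℕ→ℚ*inv≡1 (suc m) (ℕ.s≤s ℕ.z≤n)) (ℕ→ℚ*inv≡1 s 1≤s)) ⟩
    a * expCoeff s m * 1ℚ
      ≡⟨ ℚ.*-identityʳ _ ⟩
    a * expCoeff s m ∎
    where
    a = α s
    S = ℕ→ℚ s
    M = ℕ→ℚ (suc m)

  partitionSum-0 : ∀ r s → 1 ℕ.≤ s → partitionSum s r 0 ≡ 1ℚ
  partitionSum-0 zero s 1≤s = refl
  partitionSum-0 (suc r) s 1≤s = begin
    term 0 + ∑ (term ∘ suc) b   ≡⟨ cong₂ _+_ term0 (∑-zero b _ (λ m _ → guard-¬T _ (s*suc≰0 m ∘ ℕ.≤ᵇ⇒≤ _ 0))) ⟩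
    1ℚ + 0ℚ                    ≡⟨ ℚ.+-identityʳ 1ℚ ⟩
    1ℚ                         ∎
    where
    term = λ m → guard (s ℕ.* m ≤ᵇ 0) (expCoeff s m * partitionSum (suc s) r (0 ∸ s ℕ.* m))
    term0 : term 0 ≡ 1ℚ
    term0 rewrite ℕ.*-zeroʳ s = trans (cong (expCoeff s 0 *_) (partitionSum-0 r (suc s) (ℕ.s≤s ℕ.z≤n))) refl
    s*suc≰0 : ∀ m → ¬ (s ℕ.* suc m ℕ.≤ 0)
    s*suc≰0 m le = ℕ.<⇒≱ (ℕ.≤-trans 1≤s (ℕ.m≤m*n s (suc m))) le

  -- Euler's operator x d/dx on the product of factors s, …, s + r − 1, read off at x^L (for L ≤ b the
  -- truncation is invisible): x d/dx multiplies the product by Σ_{i<r} α_{s+i} x^{s+i}.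
  EulerEquation : ℕ → ℕ → Set
  EulerEquation s r = ∀ L → L ℕ.≤ b →
    ℕ→ℚ L * partitionSum s r L ≡ ∑ (λ i → guard (s ℕ.+ i ≤ᵇ L) (α (s ℕ.+ i) * partitionSum s r (L ∸ (s ℕ.+ i)))) r

  module EulerStep (s : ℕ) (1≤s : 1 ℕ.≤ s) (r : ℕ) (L : ℕ) (L≤b : L ℕ.≤ b) where

    G = partitionSum s (suc r)
    g = partitionSum (suc s) r
    c = expCoeff s

    term fromFirst fromRest F : ℕ → ℚ
    term m = guard (s ℕ.* m ≤ᵇ L) (c m * g (L ∸ s ℕ.* m))
    fromFirst m = guard (s ℕ.* m ≤ᵇ L) (ℕ→ℚ (s ℕ.* m) * c m * g (L ∸ s ℕ.* m))
    fromRest m = guard (s ℕ.* m ≤ᵇ L) (c m * (ℕ→ℚ (L ∸ s ℕ.* m) * g (L ∸ s ℕ.* m)))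
    F i = guard (s ℕ.+ i ≤ᵇ L) (α (s ℕ.+ i) * G (L ∸ (s ℕ.+ i)))

    V : ℕ → ℕ → ℚ
    V j m = guard (j ℕ.+ s ℕ.* m ≤ᵇ L) (α j * (c m * g (L ∸ j ∸ s ℕ.* m)))

    L*term : ∀ m → ℕ→ℚ L * term m ≡ fromFirst m + fromRest m
    L*term m with s ℕ.* m ℕ.≤? L
    ... | no sm≰L = trans (cong (ℕ→ℚ L *_) (guard-¬T _ (sm≰L ∘ ℕ.≤ᵇ⇒≤ _ L)))
                          (trans (ℚ.*-zeroʳ (ℕ→ℚ L)) (sym (cong₂ _+_ (guard-¬T _ (sm≰L ∘ ℕ.≤ᵇ⇒≤ _ L)) (guard-¬T _ (sm≰L ∘ ℕ.≤ᵇ⇒≤ _ L)))))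
    ... | yes sm≤L = begin
      ℕ→ℚ L * term m ≡⟨ cong (ℕ→ℚ L *_) (guard-T _ (ℕ.≤⇒≤ᵇ sm≤L)) ⟩
      ℕ→ℚ L * (c m * g (L ∸ sm)) ≡⟨ cong (λ k → ℕ→ℚ k * (c m * g (L ∸ sm))) (sym (ℕ.m+[n∸m]≡n sm≤L)) ⟩
      ℕ→ℚ (sm ℕ.+ (L ∸ sm)) * (c m * g (L ∸ sm)) ≡⟨ cong (_* (c m * g (L ∸ sm))) (ℕ→ℚ-+ sm (L ∸ sm)) ⟩
      (ℕ→ℚ sm + ℕ→ℚ (L ∸ sm)) * (c m * g (L ∸ sm))
        ≡⟨ solve 4 (λ x y c g → (x :+ y) :* (c :* g) := x :* c :* g :+ c :* (y :* g)) refl (ℕ→ℚ sm) (ℕ→ℚ (L ∸ sm)) (c m) (g (L ∸ sm)) ⟩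
      ℕ→ℚ sm * c m * g (L ∸ sm) + c m * (ℕ→ℚ (L ∸ sm) * g (L ∸ sm))
        ≡⟨ sym (cong₂ _+_ (guard-T _ (ℕ.≤⇒≤ᵇ sm≤L)) (guard-T _ (ℕ.≤⇒≤ᵇ sm≤L))) ⟩
      fromFirst m + fromRest m ∎
      where sm = s ℕ.* m

    F≡∑V : ∀ j → F j ≡ ∑ (V (s ℕ.+ j)) (suc b)
    F≡∑V j = begin
      guard B (α j′ * ∑ f (suc b))                  ≡⟨ cong (guard B) (sym (∑-*ˡ (suc b) (α j′) f)) ⟩
      guard B (∑ (λ m → α j′ * f m) (suc b))        ≡⟨ guard-∑ B (λ m → α j′ * f m) (suc b) ⟩
      ∑ (λ m → guard B (α j′ * f m)) (suc b)        ≡⟨ ∑-cong (suc b) (λ m _ → cong (guard B) (guard-*ˡ (α j′) (s ℕ.* m ≤ᵇ L ∸ j′) (c m * g (L ∸ j′ ∸ s ℕ.* m)))) ⟩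
      ∑ (λ m → guard B (guard (s ℕ.* m ≤ᵇ L ∸ j′) (α j′ * (c m * g (L ∸ j′ ∸ s ℕ.* m))))) (suc b)
                                                    ≡⟨ ∑-cong (suc b) (λ m _ → guard-≤ᵇ-+ j′ (s ℕ.* m) L (α j′ * (c m * g (L ∸ j′ ∸ s ℕ.* m)))) ⟩
      ∑ (V j′) (suc b)                              ∎
      where
      j′ = s ℕ.+ j
      B = j′ ≤ᵇ L
      f = λ m → guard (s ℕ.* m ≤ᵇ L ∸ j′) (c m * g (L ∸ j′ ∸ s ℕ.* m))

    ∑fromFirst : ∑ fromFirst (suc b) ≡ F 0
    ∑fromFirst = begin
      fromFirst 0 + ∑ (fromFirst ∘ suc) b  ≡⟨ cong₂ _+_ fromFirst0 (∑-cong b (λ m _ → fromFirst-suc m)) ⟩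
      0ℚ + ∑ (V s) b                       ≡⟨ ℚ.+-identityˡ _ ⟩
      ∑ (V s) b                            ≡⟨ sym (ℚ.+-identityʳ _) ⟩
      ∑ (V s) b + 0ℚ                       ≡⟨ cong (λ z → ∑ (V s) b + z) (sym Vb≡0) ⟩
      ∑ (V s) b + V s b                    ≡⟨ sym (∑-last b (V s)) ⟩
      ∑ (V s) (suc b)                      ≡⟨ cong (λ j → ∑ (V j) (suc b)) (sym (ℕ.+-identityʳ s)) ⟩
      ∑ (V (s ℕ.+ 0)) (suc b)              ≡⟨ sym (F≡∑V 0) ⟩
      F 0                                  ∎
      where
      fromFirst0 : fromFirst 0 ≡ 0ℚ
      fromFirst0 rewrite ℕ.*-zeroʳ s = trans (cong (_* g L) (ℚ.*-zeroˡ (c 0))) (ℚ.*-zeroˡ (g L))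
      fromFirst-suc : ∀ m → fromFirst (suc m) ≡ V s m
      fromFirst-suc m = cong₂ guard (cong (_≤ᵇ L) (ℕ.*-suc s m)) (begin
        ℕ→ℚ (s ℕ.* suc m) * c (suc m) * g (L ∸ s ℕ.* suc m)  ≡⟨ cong (_* g (L ∸ s ℕ.* suc m)) (expCoeff-suc s 1≤s m) ⟩
        α s * c m * g (L ∸ s ℕ.* suc m)                       ≡⟨ cong (λ k → α s * c m * g k) (trans (cong (L ∸_) (ℕ.*-suc s m)) (sym (ℕ.∸-+-assoc L s (s ℕ.* m)))) ⟩
        α s * c m * g (L ∸ s ∸ s ℕ.* m)                       ≡⟨ ℚ.*-assoc (α s) (c m) _ ⟩
        α s * (c m * g (L ∸ s ∸ s ℕ.* m))                     ∎)
      Vb≡0 : V s b ≡ 0ℚ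
      Vb≡0 = guard-¬T _ (λ t → ℕ.<⇒≱ (ℕ.<-≤-trans (b<s+s*b s 1≤s) (ℕ.≤ᵇ⇒≤ _ L t)) L≤b)

    ∑fromRest : EulerEquation (suc s) r → ∑ fromRest (suc b) ≡ ∑ (F ∘ suc) r
    ∑fromRest euler = begin
      ∑ fromRest (suc b)                                  ≡⟨ ∑-cong (suc b) (λ m _ → fromRest≡∑V m) ⟩
      ∑ (λ m → ∑ (λ i → V (s ℕ.+ suc i) m) r) (suc b)     ≡⟨ ∑-comm (suc b) r (λ m i → V (s ℕ.+ suc i) m) ⟩
      ∑ (λ i → ∑ (V (s ℕ.+ suc i)) (suc b)) r             ≡⟨ ∑-cong r (λ i _ → sym (F≡∑V (suc i))) ⟩
      ∑ (F ∘ suc) r                                       ∎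
      where
      fromRest≡∑V : ∀ m → fromRest m ≡ ∑ (λ i → V (s ℕ.+ suc i) m) r
      fromRest≡∑V m = begin
        guard B (c m * (ℕ→ℚ L′ * g L′))          ≡⟨ cong (λ z → guard B (c m * z)) (euler L′ (ℕ.≤-trans (ℕ.m∸n≤m L (s ℕ.* m)) L≤b)) ⟩
        guard B (c m * ∑ h r)                    ≡⟨ cong (guard B) (sym (∑-*ˡ r (c m) h)) ⟩
        guard B (∑ (λ i → c m * h i) r)          ≡⟨ guard-∑ B (λ i → c m * h i) r ⟩
        ∑ (λ i → guard B (c m * h i)) r          ≡⟨ ∑-cong r (λ i _ → step i) ⟩
        ∑ (λ i → V (s ℕ.+ suc i) m) r            ∎
        where
        B = s ℕ.* m ≤ᵇ L
        L′ = L ∸ s ℕ.* m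
        h = λ i → guard (suc s ℕ.+ i ≤ᵇ L′) (α (suc s ℕ.+ i) * g (L′ ∸ (suc s ℕ.+ i)))
        step : ∀ i → guard B (c m * h i) ≡ V (s ℕ.+ suc i) m
        step i = begin
          guard B (c m * h i)
            ≡⟨ cong (guard B) (guard-*ˡ (c m) (j ≤ᵇ L′) (α j * g (L′ ∸ j))) ⟩
          guard B (guard (j ≤ᵇ L′) (c m * (α j * g (L′ ∸ j))))
            ≡⟨ guard-≤ᵇ-+ (s ℕ.* m) j L (c m * (α j * g (L′ ∸ j))) ⟩
          guard (s ℕ.* m ℕ.+ j ≤ᵇ L) (c m * (α j * g (L′ ∸ j)))
            ≡⟨ cong₂ guard (cong (_≤ᵇ L) (ℕ.+-comm (s ℕ.* m) j))
                           (trans (solve 3 (λ c a x → c :* (a :* x) := a :* (c :* x)) refl (c m) (α j) (g (L′ ∸ j)))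
                                  (cong (λ k → α j * (c m * g k)) (∸-comm L (s ℕ.* m) j))) ⟩
          guard (j ℕ.+ s ℕ.* m ≤ᵇ L) (α j * (c m * g (L ∸ j ∸ s ℕ.* m)))
            ≡⟨ cong (λ k → V k m) (sym (ℕ.+-suc s i)) ⟩
          V (s ℕ.+ suc i) m ∎
          where
          j = suc s ℕ.+ i
          ∸-comm : ∀ L p q → L ∸ p ∸ q ≡ L ∸ q ∸ p
          ∸-comm L p q = trans (ℕ.∸-+-assoc L p q) (trans (cong (L ∸_) (ℕ.+-comm p q)) (sym (ℕ.∸-+-assoc L q p)))

    euler-suc : EulerEquation (suc s) r → ℕ→ℚ L * G L ≡ ∑ F (suc r)
    euler-suc euler = begin
      ℕ→ℚ L * ∑ term (suc b)                         ≡⟨ sym (∑-*ˡ (suc b) (ℕ→ℚ L) term) ⟩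
      ∑ (λ m → ℕ→ℚ L * term m) (suc b)               ≡⟨ ∑-cong (suc b) (λ m _ → L*term m) ⟩
      ∑ (λ m → fromFirst m + fromRest m) (suc b)     ≡⟨ ∑-+ (suc b) fromFirst fromRest ⟩
      ∑ fromFirst (suc b) + ∑ fromRest (suc b)       ≡⟨ cong₂ _+_ ∑fromFirst (∑fromRest euler) ⟩
      F 0 + ∑ (F ∘ suc) r                            ∎

  partitionSum-euler : ∀ r s → 1 ℕ.≤ s → EulerEquation s r
  partitionSum-euler zero s 1≤s zero L≤b = refl
  partitionSum-euler zero s 1≤s (suc L) L≤b = ℚ.*-zeroʳ (ℕ→ℚ (suc L))
  partitionSum-euler (suc r) s 1≤s L L≤b =
    EulerStep.euler-suc s 1≤s r L L≤b (partitionSum-euler r (suc s) (ℕ.s≤s ℕ.z≤n))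

  exponentialFormula : ∀ X → IsLogDerivative (α ∘ suc) X → X b ≡ X 0 * partitionSum 1 b b
  exponentialFormula X α↝X = isLogDerivative-unique (α ∘ suc) X (λ i → X 0 * G i) b (λ L _ → α↝X L)
    (λ L L≤b → trans (defect-*ˡ (α ∘ suc) (X 0) G L) (trans (cong (X 0 *_) (α↝G L L≤b)) (ℚ.*-zeroʳ (X 0))))
    (sym (trans (cong (X 0 *_) (partitionSum-0 b 1 (ℕ.s≤s ℕ.z≤n))) (ℚ.*-identityʳ (X 0)))) b ℕ.≤-refl
    where
    G = partitionSum 1 b
    α↝G : ∀ L → L ℕ.≤ b → defect (α ∘ suc) G L ≡ 0ℚ
    α↝G L L≤b = trans (cong (λ z → ℕ→ℚ L * G L - z)
                        (trans (sym (∑-guard-< (λ i → α (suc i) * G (L ∸ suc i)) L b L≤b))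
                               (sym (partitionSum-euler b 1 (ℕ.s≤s ℕ.z≤n) L L≤b))))
                      (ℚ.+-inverseʳ (ℕ→ℚ L * G L))

module _ (λ' μ n k b : ℕ) where
  open ExponentialFormula (A λ' μ n k) b

  ∑ₗ-prodTerm : ∀ r s L → ∑ₗ (prodTerm λ' μ n k s) (filterᵇ (λ ms → weight s ms ℕ.≡ᵇ L) (tuples b r)) ≡ partitionSum s r L
  ∑ₗ-prodTerm zero s L = trans (∑ₗ-filterᵇ (λ ms → weight s ms ℕ.≡ᵇ L) (prodTerm λ' μ n k s) ([] ∷ [])) (ℚ.+-identityʳ _)
  ∑ₗ-prodTerm (suc r) s L = begin
    ∑ₗ P (filterᵇ W (concatMap (λ m → map (m ∷_) Ms) (upTo (suc b))))
      ≡⟨ ∑ₗ-filterᵇ W P (concatMap (λ m → map (m ∷_) Ms) (upTo (suc b))) ⟩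
    ∑ₗ Q (concatMap (λ m → map (m ∷_) Ms) (upTo (suc b)))
      ≡⟨ ∑ₗ-concatMap Q (λ m → map (m ∷_) Ms) (upTo (suc b)) ⟩
    ∑ₗ (λ m → ∑ₗ Q (map (m ∷_) Ms)) (upTo (suc b))
      ≡⟨ ∑ₗ-upTo (λ m → ∑ₗ Q (map (m ∷_) Ms)) (suc b) ⟩
    ∑ (λ m → ∑ₗ Q (map (m ∷_) Ms)) (suc b)
      ≡⟨ ∑-cong (suc b) (λ m _ → first m) ⟩
    partitionSum s (suc r) L ∎
    where
    Ms = tuples b r
    P = prodTerm λ' μ n k s
    W = λ ms → weight s ms ℕ.≡ᵇ L
    Q = λ ms → guard (W ms) (P ms)
    first : ∀ m → ∑ₗ Q (map (m ∷_) Ms) ≡ guard (s ℕ.* m ≤ᵇ L) (expCoeff s m * partitionSum (suc s) r (L ∸ s ℕ.* m))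
    first m = begin
      ∑ₗ Q (map (m ∷_) Ms)
        ≡⟨ ∑ₗ-map Q (m ∷_) Ms ⟩
      ∑ₗ (λ ms → guard (s ℕ.* m ℕ.+ weight (suc s) ms ℕ.≡ᵇ L) (expCoeff s m * prodTerm λ' μ n k (suc s) ms)) Ms
        ≡⟨ ∑ₗ-cong Ms (λ ms → guard-≡ᵇ-+ (s ℕ.* m) (weight (suc s) ms) L (expCoeff s m) (prodTerm λ' μ n k (suc s) ms)) ⟩
      ∑ₗ (λ ms → guard (s ℕ.* m ≤ᵇ L) (expCoeff s m * R ms)) Ms
        ≡⟨ ∑ₗ-guard (s ℕ.* m ≤ᵇ L) (λ ms → expCoeff s m * R ms) Ms ⟩
      guard (s ℕ.* m ≤ᵇ L) (∑ₗ (λ ms → expCoeff s m * R ms) Ms)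
        ≡⟨ cong (guard (s ℕ.* m ≤ᵇ L)) (∑ₗ-*ˡ (expCoeff s m) R Ms) ⟩
      guard (s ℕ.* m ≤ᵇ L) (expCoeff s m * ∑ₗ R Ms)
        ≡⟨ cong (λ z → guard (s ℕ.* m ≤ᵇ L) (expCoeff s m * z))
                (trans (sym (∑ₗ-filterᵇ _ _ Ms)) (∑ₗ-prodTerm r (suc s) (L ∸ s ℕ.* m))) ⟩
      guard (s ℕ.* m ≤ᵇ L) (expCoeff s m * partitionSum (suc s) r (L ∸ s ℕ.* m)) ∎
      where R = λ ms → guard (weight (suc s) ms ℕ.≡ᵇ L ∸ s ℕ.* m) (prodTerm λ' μ n k (suc s) ms)

-- The rational function of the theorem

node : ℕ → ℚ
node j = - ℕ→ℚ j

node-injective : ∀ i j → node i ≡ node j → i ≡ j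
node-injective i j eq = ℕ→ℚ-injective i j (ℚ.neg-injective eq)

∑-indicator : ∀ j N x → j ℕ.< N → ∑ (λ k → guard (k ℕ.≡ᵇ j) x) N ≡ x
∑-indicator zero (suc N) x _ = trans (cong (λ z → x + z) (∑-zero N _ (λ _ _ → refl))) (ℚ.+-identityʳ x)
∑-indicator (suc j) (suc N) x (ℕ.s≤s j<N) = trans (ℚ.+-identityˡ _) (∑-indicator j N x j<N)

residue-node : ∀ k j → residue (node k) [] (node j ∷ []) ≡ guard (k ℕ.≡ᵇ j) 1ℚ
residue-node k j with node k ≟ node j
... | yes eq = sym (guard-T 1ℚ (ℕ.≡⇒≡ᵇ k j (node-injective k j eq)))
... | no ne = sym (guard-¬T 1ℚ (ne ∘ cong node ∘ ℕ.≡ᵇ⇒≡ k j))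

nodes : ℕ → List ℚ
nodes N = map node (upTo N)

∑ₗ-nodes : ∀ f N → ∑ₗ f (nodes N) ≡ ∑ (f ∘ node) N
∑ₗ-nodes f N = trans (∑ₗ-map f node (upTo N)) (∑ₗ-upTo (f ∘ node) N)

repeatEach : ℕ → (ℕ → ℚ) → ℕ → List ℚ
repeatEach m f zero = []
repeatEach m f (suc j) = replicate m (f j) ++ repeatEach m f j

module _ (m : ℕ) (f : ℕ → ℚ) where

  length-repeatEach : ∀ N → length (repeatEach m f N) ≡ N ℕ.* m
  length-repeatEach zero = refl
  length-repeatEach (suc j) = trans (List.length-++ (replicate m (f j))) (cong₂ ℕ._+_ (List.length-replicate m) (length-repeatEach j))

  all-repeatEach : ∀ {P : ℚ → Set} N → (∀ j → j ℕ.< N → P (f j)) → All P (repeatEach m f N)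
  all-repeatEach zero _ = []
  all-repeatEach (suc j) Pf = ++⁺ (replicate⁺ m (Pf j ℕ.≤-refl)) (all-repeatEach j (λ i i<j → Pf i (ℕ.m<n⇒m<1+n i<j)))

  ∑ₗ-repeatEach : ∀ g N → ∑ₗ g (repeatEach m f N) ≡ ℕ→ℚ m * ∑ (g ∘ f) N
  ∑ₗ-repeatEach g zero = sym (ℚ.*-zeroʳ (ℕ→ℚ m))
  ∑ₗ-repeatEach g (suc j) = begin
    ∑ₗ g (replicate m (f j) ++ repeatEach m f j)     ≡⟨ ∑ₗ-replicate g m (f j) (repeatEach m f j) ⟩
    ℕ→ℚ m * g (f j) + ∑ₗ g (repeatEach m f j)        ≡⟨ cong (λ z → ℕ→ℚ m * g (f j) + z) (∑ₗ-repeatEach g j) ⟩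
    ℕ→ℚ m * g (f j) + ℕ→ℚ m * ∑ (g ∘ f) j            ≡⟨ solve 3 (λ m a s → m :* a :+ m :* s := m :* (s :+ a)) refl (ℕ→ℚ m) (g (f j)) (∑ (g ∘ f) j) ⟩
    ℕ→ℚ m * (∑ (g ∘ f) j + g (f j))                  ≡⟨ cong (ℕ→ℚ m *_) (sym (∑-last j (g ∘ f))) ⟩
    ℕ→ℚ m * ∑ (g ∘ f) (suc j)                        ∎

  ∏ₗ-repeatEach : ∀ g N → ∏ₗ g (repeatEach m f N) ≡ ∏ (g ∘ f) N ^ℚ m
  ∏ₗ-repeatEach g zero = sym (1^ℚ≡1 m)
  ∏ₗ-repeatEach g (suc j) = begin
    ∏ₗ g (replicate m (f j) ++ repeatEach m f j)     ≡⟨ ∏ₗ-replicate g m (f j) (repeatEach m f j) ⟩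
    g (f j) ^ℚ m * ∏ₗ g (repeatEach m f j)           ≡⟨ cong (g (f j) ^ℚ m *_) (∏ₗ-repeatEach g j) ⟩
    g (f j) ^ℚ m * ∏ (g ∘ f) j ^ℚ m                  ≡⟨ sym (^ℚ-distribʳ-* (g (f j)) (∏ (g ∘ f) j) m) ⟩
    (g (f j) * ∏ (g ∘ f) j) ^ℚ m                     ≡⟨ cong (_^ℚ m) (trans (ℚ.*-comm (g (f j)) _) (sym (∏-last j (g ∘ f)))) ⟩
    ∏ (g ∘ f) (suc j) ^ℚ m                           ∎

poleOrder-++ : ∀ c xs ys → poleOrder c (xs ++ ys) ≡ poleOrder c xs ℕ.+ poleOrder c ys
poleOrder-++ c [] ys = refl
poleOrder-++ c (a ∷ xs) ys with c ≟ a
... | yes _ = cong suc (poleOrder-++ c xs ys)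
... | no _ = poleOrder-++ c xs ys

module _ (m : ℕ) where

  poleOrder-repeatEach-≥ : ∀ k N → N ℕ.≤ k → poleOrder (node k) (repeatEach m node N) ≡ 0
  poleOrder-repeatEach-≥ k zero _ = refl
  poleOrder-repeatEach-≥ k (suc j) j<k = begin
    poleOrder (node k) (replicate m (node j) ++ repeatEach m node j)   ≡⟨ poleOrder-++ (node k) (replicate m (node j)) _ ⟩
    poleOrder (node k) (replicate m (node j)) ℕ.+ poleOrder (node k) (repeatEach m node j)
      ≡⟨ cong₂ ℕ._+_ (poleOrder-absent (node k) (node j) (ℕ.<⇒≢ j<k ∘ sym ∘ node-injective k j) (replicate⁺ m refl))
                     (poleOrder-repeatEach-≥ k j (ℕ.<⇒≤ j<k)) ⟩
    0 ∎

  poleOrder-repeatEach-< : ∀ k N → k ℕ.< N → poleOrder (node k) (repeatEach m node N) ≡ m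
  poleOrder-repeatEach-< k (suc j) k<1+j = trans (poleOrder-++ (node k) (replicate m (node j)) _) (cases (ℕ.m≤n⇒m<n∨m≡n (ℕ.≤-pred k<1+j)))
    where
    cases : k ℕ.< j ⊎ k ≡ j → poleOrder (node k) (replicate m (node j)) ℕ.+ poleOrder (node k) (repeatEach m node j) ≡ m
    cases (inj₁ k<j) = cong₂ ℕ._+_ (poleOrder-absent (node k) (node j) (ℕ.<⇒≢ k<j ∘ node-injective k j) (replicate⁺ m refl))
                                   (poleOrder-repeatEach-< k j k<j)
    cases (inj₂ refl) = trans (cong₂ ℕ._+_ (trans (poleOrder-replicate (node k) (node k) refl (replicate⁺ m refl)) (List.length-replicate m))
                                           (poleOrder-repeatEach-≥ k k ℕ.≤-refl)) (ℕ.+-identityʳ m)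

H≡∑ : ∀ i m → H i m ≡ ∑ (λ d → inv (suc d ℕ.^ i)) m
H≡∑ i m = ∑ₗ-upTo (λ d → inv (suc d ℕ.^ i)) m

node-node-below : ∀ k j → j ℕ.≤ k → node k - node j ≡ - ℕ→ℚ (k ∸ j)
node-node-below k j j≤k = trans (solve 2 (λ a b → :- a :- (:- b) := :- (a :- b)) refl (ℕ→ℚ k) (ℕ→ℚ j)) (cong -_ (sym (ℕ→ℚ-∸ k j j≤k)))

node-node-above : ∀ k t → node k - node (k ℕ.+ suc t) ≡ ℕ→ℚ (suc t)
node-node-above k t = trans (cong (λ z → node k - (- z)) (ℕ→ℚ-+ k (suc t))) (solve 2 (λ a b → :- a :- (:- (a :+ b)) := b) refl (ℕ→ℚ k) (ℕ→ℚ (suc t)))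

node-root : ∀ k j → node k - ℕ→ℚ (suc j) ≡ - ℕ→ℚ (suc (k ℕ.+ j))
node-root k j = trans (solve 2 (λ a b → :- a :- b := :- (a :+ b)) refl (ℕ→ℚ k) (ℕ→ℚ (suc j)))
  (cong -_ (trans (sym (ℕ→ℚ-+ k (suc j))) (cong ℕ→ℚ (ℕ.+-suc k j))))

binomial : ∀ n k → k ℕ.≤ n → ℕ→ℚ (n !) ≡ ℕ→ℚ (n C k) * (ℕ→ℚ (k !) * ℕ→ℚ ((n ∸ k) !))
binomial n k k≤n = begin
  ℕ→ℚ (n !)                                      ≡⟨ cong ℕ→ℚ (sym nCk*k!*[n-k]!≡n!) ⟩
  ℕ→ℚ ((n C k) ℕ.* (k ! ℕ.* (n ∸ k) !))            ≡⟨ ℕ→ℚ-* (n C k) (k ! ℕ.* (n ∸ k) !) ⟩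
  ℕ→ℚ (n C k) * ℕ→ℚ (k ! ℕ.* (n ∸ k) !)          ≡⟨ cong (ℕ→ℚ (n C k) *_) (ℕ→ℚ-* (k !) ((n ∸ k) !)) ⟩
  ℕ→ℚ (n C k) * (ℕ→ℚ (k !) * ℕ→ℚ ((n ∸ k) !))    ∎
  where
  nCk*k!*[n-k]!≡n! : (n C k) ℕ.* (k ! ℕ.* (n ∸ k) !) ≡ n !
  nCk*k!*[n-k]!≡n! = trans (cong (ℕ._* (k ! ℕ.* (n ∸ k) !)) (nCk≡n!/k![n-k]! k≤n))
    (m/n*n≡m {{ℕ._!*_!≢0 k (n ∸ k)}} (k![n∸k]!∣n! k≤n))

-- n μ zeros against (n + 1) λ' poles: the hypothesis says the function vanishes to order ≥ 2 at infinity.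
degreeGap : ∀ l m n → (+ 1) ℤ.< (+ l) ℤ.+ ((+ l) ℤ.- (+ m)) ℤ.* (+ n) → n ℕ.* m ℕ.+ 2 ℕ.≤ suc n ℕ.* l
degreeGap l m n hyp = subst (ℕ._≤ suc n ℕ.* l) (ℕ.+-comm 2 (n ℕ.* m)) (ℤ.drop‿+<+ (subst (+ suc (n ℕ.* m) ℤ.<_) shifted (ℤ.+-monoˡ-< (+ (n ℕ.* m)) hyp)))
  where
  distrib : ∀ l m n → l ℤ.+ (l ℤ.- m) ℤ.* n ℤ.+ n ℤ.* m ≡ (+ 1 ℤ.+ n) ℤ.* l
  distrib = solve-∀
  shifted : (+ l) ℤ.+ ((+ l) ℤ.- (+ m)) ℤ.* (+ n) ℤ.+ (+ (n ℕ.* m)) ≡ + (suc n ℕ.* l)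
  shifted = begin
    + l ℤ.+ (+ l ℤ.- + m) ℤ.* + n ℤ.+ + (n ℕ.* m)     ≡⟨ cong (λ z → + l ℤ.+ (+ l ℤ.- + m) ℤ.* + n ℤ.+ z) (ℤ.pos-* n m) ⟩
    + l ℤ.+ (+ l ℤ.- + m) ℤ.* + n ℤ.+ + n ℤ.* + m     ≡⟨ distrib (+ l) (+ m) (+ n) ⟩
    (+ 1 ℤ.+ + n) ℤ.* + l                             ≡⟨ sym (ℤ.pos-* (suc n) l) ⟩
    + (suc n ℕ.* l)                                   ∎

-- Encodes ∏_{j=1}^{n} (x − j)^μ / ∏_{j=0}^{n} (x + j)^λ', whose poles are the points −n, …, 0.
module RationalFunction (λ' μ n : ℕ) where

  points poles zeros : List ℚ
  points = nodes (suc n)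
  poles = repeatEach λ' node (suc n)
  zeros = repeatEach μ (ℕ→ℚ ∘ suc) n

  covers : Covers points poles
  covers = all-repeatEach λ' node (suc n) (λ j j≤n → begin
    ∑ₗ (λ c → residue c [] (node j ∷ [])) points          ≡⟨ ∑ₗ-nodes (λ c → residue c [] (node j ∷ [])) (suc n) ⟩
    ∑ (λ k → residue (node k) [] (node j ∷ [])) (suc n)   ≡⟨ ∑-cong (suc n) (λ k _ → residue-node k j) ⟩
    ∑ (λ k → guard (k ℕ.≡ᵇ j) 1ℚ) (suc n)                ≡⟨ ∑-indicator j (suc n) 1ℚ j≤n ⟩
    1ℚ                                                    ∎)

  zeros-avoid : ∀ k → All (node k ≢_) zeros
  zeros-avoid k = all-repeatEach μ (ℕ→ℚ ∘ suc) n (λ j _ eq → ℕ→ℚ≢0 (suc (k ℕ.+ j)) (ℕ.s≤s ℕ.z≤n) (begin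
    ℕ→ℚ (suc (k ℕ.+ j))                  ≡⟨ solve 1 (λ x → x := :- (:- x)) refl (ℕ→ℚ (suc (k ℕ.+ j))) ⟩
    - - ℕ→ℚ (suc (k ℕ.+ j))              ≡⟨ cong -_ (sym (node-root k j)) ⟩
    - (node k - ℕ→ℚ (suc j))             ≡⟨ cong (λ z → - (z - ℕ→ℚ (suc j))) eq ⟩
    - (ℕ→ℚ (suc j) - ℕ→ℚ (suc j))        ≡⟨ cong -_ (ℚ.+-inverseʳ (ℕ→ℚ (suc j))) ⟩
    0ℚ                                   ∎))

  scale : ℚ
  scale = (sgn n * ℕ→ℚ (n !) ⁻¹) ^ℚ μ * ℕ→ℚ (n !) ^ℚ λ'

  module AtNode (k : ℕ) (k≤n : k ℕ.≤ n) where

    c = node k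

    laurent : Series
    laurent = mulZeros c zeros (regularPart c poles)

    poleSum : ∀ i → ∑ (λ j → poleCoeff c (node j) i) (suc n) ≡ - H (suc i) k + sgn i * H (suc i) (n ∸ k)
    poleSum i = begin
      ∑ f (suc n)                                                 ≡⟨ ∑-around f k n k≤n ⟩
      ∑ f k + (f k + ∑ (λ t → f (k ℕ.+ suc t)) (n ∸ k))           ≡⟨ cong₂ (λ x y → x + (f k + y)) below above ⟩
      - H (suc i) k + (f k + sgn i * H (suc i) (n ∸ k))           ≡⟨ cong (λ z → - H (suc i) k + (z + sgn i * H (suc i) (n ∸ k))) (poleCoeff-≡ c c i refl) ⟩
      - H (suc i) k + (0ℚ + sgn i * H (suc i) (n ∸ k))            ≡⟨ cong (λ z → - H (suc i) k + z) (ℚ.+-identityˡ _) ⟩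
      - H (suc i) k + sgn i * H (suc i) (n ∸ k)                   ∎
      where
      f = λ j → poleCoeff c (node j) i
      g = λ x → inv (x ℕ.^ suc i)
      below : ∑ f k ≡ - H (suc i) k
      below = begin
        ∑ f k                          ≡⟨ ∑-cong k (λ j j<k → trans (poleCoeff-≢ c (node j) i (ℕ.<⇒≢ j<k ∘ sym ∘ node-injective k j))
                                                            (trans (cong (λ z → recipCoeff z i) (node-node-below k j (ℕ.<⇒≤ j<k)))
                                                            (trans (recipCoeff-neg (ℕ→ℚ (k ∸ j)) i) (cong -_ (ℕ→ℚ⁻¹-^ℚ (k ∸ j) (suc i)))))) ⟩
        ∑ (λ j → - g (k ∸ j)) k        ≡⟨ ∑-neg k (λ j → g (k ∸ j)) ⟩
        - ∑ (λ j → g (k ∸ j)) k        ≡⟨ cong -_ (trans (∑-reverse g k) (sym (H≡∑ (suc i) k))) ⟩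
        - H (suc i) k                  ∎
      above : ∑ (λ t → f (k ℕ.+ suc t)) (n ∸ k) ≡ sgn i * H (suc i) (n ∸ k)
      above = begin
        ∑ (λ t → f (k ℕ.+ suc t)) (n ∸ k)
          ≡⟨ ∑-cong (n ∸ k) (λ t _ → trans (poleCoeff-≢ c (node (k ℕ.+ suc t)) i (ℕ.m≢1+m+n k ∘ (λ e → trans e (ℕ.+-suc k t)) ∘ node-injective k _))
                                           (trans (cong (λ z → recipCoeff z i) (node-node-above k t)) (cong (sgn i *_) (ℕ→ℚ⁻¹-^ℚ (suc t) (suc i))))) ⟩
        ∑ (λ t → sgn i * g (suc t)) (n ∸ k)     ≡⟨ ∑-*ˡ (n ∸ k) (sgn i) (g ∘ suc) ⟩
        sgn i * ∑ (g ∘ suc) (n ∸ k)             ≡⟨ cong (sgn i *_) (sym (H≡∑ (suc i) (n ∸ k))) ⟩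
        sgn i * H (suc i) (n ∸ k)               ∎

    zeroSum : ∀ i → ∑ (λ j → recipCoeff (c - ℕ→ℚ (suc j)) i) n ≡ H (suc i) k - H (suc i) (n ℕ.+ k)
    zeroSum i = begin
      ∑ (λ j → recipCoeff (c - ℕ→ℚ (suc j)) i) n
        ≡⟨ ∑-cong n (λ j _ → trans (cong (λ z → recipCoeff z i) (node-root k j))
                             (trans (recipCoeff-neg (ℕ→ℚ (suc (k ℕ.+ j))) i) (cong -_ (ℕ→ℚ⁻¹-^ℚ (suc (k ℕ.+ j)) (suc i))))) ⟩
      ∑ (λ j → - g (k ℕ.+ j)) n                          ≡⟨ ∑-neg n (λ j → g (k ℕ.+ j)) ⟩
      - ∑ (λ j → g (k ℕ.+ j)) n                          ≡⟨ solve 2 (λ a b → :- b := a :- (a :+ b)) refl (∑ g k) (∑ (λ j → g (k ℕ.+ j)) n) ⟩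
      ∑ g k - (∑ g k + ∑ (λ j → g (k ℕ.+ j)) n)          ≡⟨ cong (λ z → ∑ g k - z) (sym (∑-split k n g)) ⟩
      ∑ g k - ∑ g (k ℕ.+ n)                              ≡⟨ cong₂ (λ x y → x - ∑ g y) (sym (H≡∑ (suc i) k)) (ℕ.+-comm k n) ⟩
      H (suc i) k - ∑ g (n ℕ.+ k)                        ≡⟨ cong (λ z → H (suc i) k - z) (sym (H≡∑ (suc i) (n ℕ.+ k))) ⟩
      H (suc i) k - H (suc i) (n ℕ.+ k)                  ∎
      where g = λ d → inv (suc d ℕ.^ suc i)

    isLogDerivative-laurent : IsLogDerivative (A λ' μ n k ∘ suc) laurent
    isLogDerivative-laurent = isLogDerivative-congˡ laurent coefficients
      (isLogDerivative-mulZeros c zeros {λ i → - ∑ₗ (λ a → poleCoeff c a i) poles} (regularPart c poles) (zeros-avoid k) (isLogDerivative-regularPart c poles))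
      where
      coefficients : ∀ i → - ∑ₗ (λ a → poleCoeff c a i) poles + ∑ₗ (λ r → recipCoeff (c - r) i) zeros ≡ A λ' μ n k (suc i)
      coefficients i = begin
        - ∑ₗ (λ a → poleCoeff c a i) poles + ∑ₗ (λ r → recipCoeff (c - r) i) zeros
          ≡⟨ cong₂ (λ x y → - x + y) (∑ₗ-repeatEach λ' node _ (suc n)) (∑ₗ-repeatEach μ (ℕ→ℚ ∘ suc) _ n) ⟩
        - (ℕ→ℚ λ' * ∑ (λ j → poleCoeff c (node j) i) (suc n)) + ℕ→ℚ μ * ∑ (λ j → recipCoeff (c - ℕ→ℚ (suc j)) i) n
          ≡⟨ cong₂ (λ x y → - (ℕ→ℚ λ' * x) + ℕ→ℚ μ * y) (poleSum i) (zeroSum i) ⟩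
        - (ℕ→ℚ λ' * (- Hk + sgn i * Hn-k)) + ℕ→ℚ μ * (Hk - Hn+k)
          ≡⟨ solve 6 (λ l m a b d s → :- (l :* (:- a :+ s :* b)) :+ m :* (a :- d) := l :* (a :+ ((:- con 1ℚ) :* s) :* b) :+ m :* (a :- d))
                   refl (ℕ→ℚ λ') (ℕ→ℚ μ) Hk Hn-k Hn+k (sgn i) ⟩
        A λ' μ n k (suc i) ∎
        where
        Hk = H (suc i) k
        Hn-k = H (suc i) (n ∸ k)
        Hn+k = H (suc i) (n ℕ.+ k)

    residue≡coeffBelow : residue c zeros poles ≡ coeffBelow λ' laurent
    residue≡coeffBelow = cong (λ e → coeffBelow e laurent) (poleOrder-repeatEach-< λ' k (suc n) (ℕ.s≤s k≤n))

    zeroProduct : sgn n * ℕ→ℚ (n !) ⁻¹ * ∏ (λ j → c - ℕ→ℚ (suc j)) n ≡ ℕ→ℚ ((n ℕ.+ k) C k)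
    zeroProduct = begin
      sgn n * n! ⁻¹ * ∏ (λ j → c - ℕ→ℚ (suc j)) n       ≡⟨ cong (sgn n * n! ⁻¹ *_) (trans (∏-cong n (λ j _ → node-root k j)) (∏-neg n f)) ⟩
      sgn n * n! ⁻¹ * (sgn n * ∏ f n)                    ≡⟨ cong (λ z → sgn n * n! ⁻¹ * (sgn n * z)) ∏f≡ ⟩
      sgn n * n! ⁻¹ * (sgn n * (B * n!))                 ≡⟨ solve 4 (λ s r a f → s :* r :* (s :* (a :* f)) := s :* s :* (a :* (f :* r))) refl (sgn n) (n! ⁻¹) B n! ⟩
      sgn n * sgn n * (B * (n! * n! ⁻¹))                 ≡⟨ cong₂ (λ x y → x * (B * y)) (sgn*sgn≡1 n) (*-inverseʳ′ n! (ℕ→ℚ-!≢0 n)) ⟩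
      1ℚ * (B * 1ℚ)                                      ≡⟨ trans (ℚ.*-identityˡ _) (ℚ.*-identityʳ B) ⟩
      B                                                  ∎
      where
      n! = ℕ→ℚ (n !)
      k! = ℕ→ℚ (k !)
      B = ℕ→ℚ ((n ℕ.+ k) C k)
      f = λ j → ℕ→ℚ (suc (k ℕ.+ j))
      ∏f≡ : ∏ f n ≡ B * n!
      ∏f≡ = *-cancelʳ′ (∏ f n) (B * n!) k! (ℕ→ℚ-!≢0 k) (begin
        ∏ f n * k!                                 ≡⟨ ℚ.*-comm (∏ f n) k! ⟩
        k! * ∏ f n                                 ≡⟨ ∏-factorial k n ⟩
        ℕ→ℚ ((k ℕ.+ n) !)                          ≡⟨ cong (λ z → ℕ→ℚ (z !)) (ℕ.+-comm k n) ⟩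
        ℕ→ℚ ((n ℕ.+ k) !)                          ≡⟨ binomial (n ℕ.+ k) k (ℕ.m≤n+m k n) ⟩
        B * (k! * ℕ→ℚ ((n ℕ.+ k ∸ k) !))           ≡⟨ cong (λ z → B * (k! * ℕ→ℚ (z !))) (ℕ.m+n∸n≡m n k) ⟩
        B * (k! * n!)                              ≡⟨ solve 3 (λ a b c → a :* (b :* c) := a :* c :* b) refl B k! n! ⟩
        B * n! * k!                                ∎)

    poleProduct : ℕ→ℚ (n !) * ∏ (poleFactor c ∘ node) (suc n) ≡ sgn k * ℕ→ℚ (n C k)
    poleProduct = begin
      n! * ∏ f (suc n)
        ≡⟨ cong (n! *_) (∏-around f k n k≤n) ⟩
      n! * (∏ f k * (f k * ∏ (λ t → f (k ℕ.+ suc t)) (n ∸ k)))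
        ≡⟨ cong₂ (λ x y → n! * (x * y)) below (cong₂ _*_ (poleFactor-≡ c c refl) above) ⟩
      n! * ((sgn k * k!) ⁻¹ * (1ℚ * m! ⁻¹))
        ≡⟨ cong₂ (λ x y → x * (y * (1ℚ * m! ⁻¹))) (binomial n k k≤n) (trans (⁻¹-distrib-* (sgn k) k!) (cong (_* k! ⁻¹) (sgn⁻¹ k))) ⟩
      B * (k! * m!) * (sgn k * k! ⁻¹ * (1ℚ * m! ⁻¹))
        ≡⟨ solve 6 (λ a b c s b′ c′ → a :* (b :* c) :* (s :* b′ :* (con 1ℚ :* c′)) := s :* a :* ((b :* b′) :* (c :* c′)))
                 refl B k! m! (sgn k) (k! ⁻¹) (m! ⁻¹) ⟩
      sgn k * B * ((k! * k! ⁻¹) * (m! * m! ⁻¹))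
        ≡⟨ cong₂ (λ x y → sgn k * B * (x * y)) (*-inverseʳ′ k! (ℕ→ℚ-!≢0 k)) (*-inverseʳ′ m! (ℕ→ℚ-!≢0 (n ∸ k))) ⟩
      sgn k * B * 1ℚ                                              ≡⟨ ℚ.*-identityʳ _ ⟩
      sgn k * B                                                   ∎
      where
      n! = ℕ→ℚ (n !)
      k! = ℕ→ℚ (k !)
      m! = ℕ→ℚ ((n ∸ k) !)
      B = ℕ→ℚ (n C k)
      f = poleFactor c ∘ node
      below : ∏ f k ≡ (sgn k * k!) ⁻¹
      below = begin
        ∏ f k                                 ≡⟨ ∏-cong k (λ j j<k → trans (poleFactor-≢ c (node j) (ℕ.<⇒≢ j<k ∘ sym ∘ node-injective k j))
                                                                         (cong _⁻¹ (node-node-below k j (ℕ.<⇒≤ j<k)))) ⟩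
        ∏ (λ j → (- ℕ→ℚ (k ∸ j)) ⁻¹) k        ≡⟨ ∏-⁻¹ k (λ j → - ℕ→ℚ (k ∸ j)) ⟩
        (∏ (λ j → - ℕ→ℚ (k ∸ j)) k) ⁻¹        ≡⟨ cong _⁻¹ (∏-neg k (λ j → ℕ→ℚ (k ∸ j))) ⟩
        (sgn k * ∏ (λ j → ℕ→ℚ (k ∸ j)) k) ⁻¹  ≡⟨ cong (λ z → (sgn k * z) ⁻¹) (trans (∏-reverse ℕ→ℚ k) (∏-factorial₀ k)) ⟩
        (sgn k * k!) ⁻¹                       ∎
      above : ∏ (λ t → f (k ℕ.+ suc t)) (n ∸ k) ≡ m! ⁻¹
      above = begin
        ∏ (λ t → f (k ℕ.+ suc t)) (n ∸ k)
          ≡⟨ ∏-cong (n ∸ k) (λ t _ → trans (poleFactor-≢ c (node (k ℕ.+ suc t)) (ℕ.m≢1+m+n k ∘ (λ e → trans e (ℕ.+-suc k t)) ∘ node-injective k _))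
                                           (cong _⁻¹ (node-node-above k t))) ⟩
        ∏ (λ t → ℕ→ℚ (suc t) ⁻¹) (n ∸ k)     ≡⟨ ∏-⁻¹ (n ∸ k) (ℕ→ℚ ∘ suc) ⟩
        (∏ (ℕ→ℚ ∘ suc) (n ∸ k)) ⁻¹           ≡⟨ cong _⁻¹ (∏-factorial₀ (n ∸ k)) ⟩
        m! ⁻¹                                 ∎

    laurent-0 : laurent 0 ≡ ∏ (λ j → c - ℕ→ℚ (suc j)) n ^ℚ μ * ∏ (poleFactor c ∘ node) (suc n) ^ℚ λ'
    laurent-0 = trans (mulZeros-0 c zeros (regularPart c poles))
      (cong₂ _*_ (∏ₗ-repeatEach μ (ℕ→ℚ ∘ suc) (λ r → c - r) n) (trans (regularPart-0 c poles) (∏ₗ-repeatEach λ' node (poleFactor c) (suc n))))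

    binomials≡scale*laurent-0 : sgn (k ℕ.* λ') * ℕ→ℚ (n C k) ^ℚ λ' * ℕ→ℚ ((n ℕ.+ k) C k) ^ℚ μ ≡ scale * laurent 0
    binomials≡scale*laurent-0 = sym (begin
      (u ^ℚ μ * v ^ℚ λ') * laurent 0                 ≡⟨ cong ((u ^ℚ μ * v ^ℚ λ') *_) laurent-0 ⟩
      (u ^ℚ μ * v ^ℚ λ') * (Z ^ℚ μ * P ^ℚ λ')        ≡⟨ solve 4 (λ a b x y → (a :* b) :* (x :* y) := (a :* x) :* (b :* y)) refl (u ^ℚ μ) (v ^ℚ λ') (Z ^ℚ μ) (P ^ℚ λ') ⟩
      (u ^ℚ μ * Z ^ℚ μ) * (v ^ℚ λ' * P ^ℚ λ')        ≡⟨ cong₂ _*_ (sym (^ℚ-distribʳ-* u Z μ)) (sym (^ℚ-distribʳ-* v P λ')) ⟩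
      (u * Z) ^ℚ μ * (v * P) ^ℚ λ'                   ≡⟨ cong₂ (λ x y → x ^ℚ μ * y ^ℚ λ') zeroProduct poleProduct ⟩
      B′ ^ℚ μ * (sgn k * B) ^ℚ λ'                    ≡⟨ cong (B′ ^ℚ μ *_) (^ℚ-distribʳ-* (sgn k) B λ') ⟩
      B′ ^ℚ μ * (sgn k ^ℚ λ' * B ^ℚ λ')              ≡⟨ cong (λ z → B′ ^ℚ μ * (z * B ^ℚ λ')) (sym (^ℚ-*-assoc (- 1ℚ) k λ')) ⟩
      B′ ^ℚ μ * (sgn (k ℕ.* λ') * B ^ℚ λ')           ≡⟨ solve 3 (λ a s b → a :* (s :* b) := s :* b :* a) refl (B′ ^ℚ μ) (sgn (k ℕ.* λ')) (B ^ℚ λ') ⟩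
      sgn (k ℕ.* λ') * B ^ℚ λ' * B′ ^ℚ μ             ∎)
      where
      u = sgn n * ℕ→ℚ (n !) ⁻¹
      v = ℕ→ℚ (n !)
      Z = ∏ (λ j → c - ℕ→ℚ (suc j)) n
      P = ∏ (poleFactor c ∘ node) (suc n)
      B = ℕ→ℚ (n C k)
      B′ = ℕ→ℚ ((n ℕ.+ k) C k)

  summand : ℕ → ℚ
  summand k = sgn (k ℕ.* λ') * ℕ→ℚ (n C k) ^ℚ λ' * ℕ→ℚ ((n ℕ.+ k) C k) ^ℚ μ * Ω (λ' ∸ 1) λ' μ n k

  summand≡residue : 1 ℕ.≤ λ' → ∀ k → k ℕ.≤ n → summand k ≡ scale * ℕ→ℚ ((λ' ∸ 1) !) * residue (node k) zeros poles
  summand≡residue 1≤λ' k k≤n = begin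
    binomials * (ℕ→ℚ (ℓ !) * ∑ₗ (prodTerm λ' μ n k 1) (partitions ℓ))
      ≡⟨ cong₂ (λ x y → x * (ℕ→ℚ (ℓ !) * y)) binomials≡scale*laurent-0 (∑ₗ-prodTerm λ' μ n k ℓ ℓ 1 ℓ) ⟩
    scale * laurent 0 * (ℕ→ℚ (ℓ !) * partitionSum 1 ℓ ℓ)
      ≡⟨ solve 4 (λ a s f g → a :* s :* (f :* g) := a :* f :* (s :* g)) refl scale (laurent 0) (ℕ→ℚ (ℓ !)) (partitionSum 1 ℓ ℓ) ⟩
    scale * ℕ→ℚ (ℓ !) * (laurent 0 * partitionSum 1 ℓ ℓ)
      ≡⟨ cong (scale * ℕ→ℚ (ℓ !) *_) (sym (exponentialFormula laurent isLogDerivative-laurent)) ⟩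
    scale * ℕ→ℚ (ℓ !) * laurent ℓ
      ≡⟨ cong (scale * ℕ→ℚ (ℓ !) *_) (sym (trans residue≡coeffBelow (coeffBelow≡ laurent 1≤λ'))) ⟩
    scale * ℕ→ℚ (ℓ !) * residue (node k) zeros poles ∎
    where
    open AtNode k k≤n
    ℓ = λ' ∸ 1
    open ExponentialFormula (A λ' μ n k) ℓ
    binomials = sgn (k ℕ.* λ') * ℕ→ℚ (n C k) ^ℚ λ' * ℕ→ℚ ((n ℕ.+ k) C k) ^ℚ μ

  degree : (+ 1) ℤ.< (+ λ') ℤ.+ ((+ λ') ℤ.- (+ μ)) ℤ.* (+ n) → length zeros ℕ.+ 2 ℕ.≤ length poles
  degree hyp = subst₂ (λ a b → a ℕ.+ 2 ℕ.≤ b) (sym (length-repeatEach μ (ℕ→ℚ ∘ suc) n)) (sym (length-repeatEach λ' node (suc n)))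
    (degreeGap λ' μ n hyp)

mainTheorem2 : (λ' μ n : ℕ) → 1 ≤ λ' → (+ 1) ℤ.< (+ λ') ℤ.+ ((+ λ') ℤ.- (+ μ)) ℤ.* (+ n) →
    mainSum λ' μ n ≡ 0ℚ
mainTheorem2 λ' μ n 1≤λ' hyp = begin
  mainSum λ' μ n                                        ≡⟨ ∑ₗ-upTo summand (suc n) ⟩
  ∑ summand (suc n)                                     ≡⟨ ∑-cong (suc n) (λ k k<1+n → summand≡residue 1≤λ' k (ℕ.≤-pred k<1+n)) ⟩
  ∑ (λ k → K * residue (node k) zeros poles) (suc n)    ≡⟨ ∑-*ˡ (suc n) K (λ k → residue (node k) zeros poles) ⟩
  K * ∑ (λ k → residue (node k) zeros poles) (suc n)    ≡⟨ cong (K *_) (sym (∑ₗ-nodes (λ c → residue c zeros poles) (suc n))) ⟩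
  K * totalResidue points zeros poles                   ≡⟨ cong (K *_) (totalResidue≡0 points zeros poles (degree hyp) covers) ⟩
  K * 0ℚ                                                ≡⟨ ℚ.*-zeroʳ K ⟩
  0ℚ                                                    ∎
  where
  open RationalFunction λ' μ n
  K = scale * ℕ→ℚ ((λ' ∸ 1) !)
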